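{- For every $X \in \{0,1\}^\omega$ the following are equivalent: (1) $X$ is Martin-Löf $\mathrm{BP}$ random; (2) $X$ is Kolmogorov $\mathrm{BP}$ random; (3) $X$ is quick process $\mathrm{BP}$ random.
   Context: Reals are elements $X\in\{0,1\}^\omega$. $X\upharpoonright n$ is the initial segment of length $n$. For a finite string $\sigma$, $[\sigma]=\{Y\in\{0,1\}^\omega:\sigma\sqsubset Y\}$, and for a set $G$ of strings $[G]=\bigcup_{\sigma\in G}[\sigma]$. $\mu$ is the uniform (Lebesgue) measure on $\{0,1\}^\omega$. Finite strings and finite sets of strings are coded by natural numbers in a standard primitive recursive way. A sequence $(U_n)_{n\ge0}$ of clopen sets is primitive recursive if there is a primitive recursive function $g$ such that $g(n)$ codes a finite set $G_n$ of strings with $U_n=[G_n]$. A primitive recursive test is such a sequence with $\mu(U_n)\le 2^{ -n}$ for all $n$. $X$ is Martin-Löf $\mathrm{BP}$ random if for every primitive recursive test $(U_n)$ there is $n$ with $X\notin U_n$. For $M:\{0,1\}^*\to\{0,1\}^*$, $C_M(\tau)$ is the least length $|\sigma|$ of a string $\sigma$ with $M(\sigma)=\tau$ (infinite if there is none). $X$ is primitive recursively compressed by $M$ if there is a primitive recursive $f:\mathbb N\to\mathbb N$ with $C_M(X\upharpoonright f(c))\le f(c)-c$ for every $c\in\mathbb N$. $X$ is Kolmogorov $\mathrm{BP}$ random if it is not primitive recursively compressed by any primitive recursive $M:\{0,1\}^*\to\{0,1\}^*$. A quick process $\mathrm{BP}$ machine is a total primitive recursive $M:\{0,1\}^*\to\{0,1\}^*$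 such that: - $\tau\sqsubseteq\tau'$ implies $M(\tau)\sqsubseteq M(\tau')$; - there is a primitive recursive order function $h$ (nondecreasing with $\lim_n h(n)=\infty$) such that $|M(\tau)|\ge h(|\tau|)$ for all $\tau$. $X$ is quick process $\mathrm{BP}$ random if it is not primitive recursively compressed by any quick process $\mathrm{BP}$ machine. -}

module Defs where

open import Data.Nat using (ℕ; zero; suc; _+_; _*_; _^_; _≤_; _⊔_)
open import Data.Bool using (Bool; true; false; _∧_)
open import Data.Fin using (Fin)
open import Data.Vec using (Vec; []; _∷_; lookup)
open import Data.List using (List; []; _∷_; _++_; length; map; foldr; filterᵇ)
open import Data.Bool.ListAction using (any)
open import Data.List.Relation.Unary.Any using (Any)
open import Data.Product using (Σ; ∃; _×_; _,_)
open import Relation.Binary.PropositionalEquality using (_≡_)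
open import Relation.Nullary using (¬_)

Real : Set
Real = ℕ → Bool

Str : Set
Str = List Bool

_↾_ : Real → ℕ → Str
X ↾ zero  = []
X ↾ suc n = X 0 ∷ ((λ k → X (suc k)) ↾ n)

_⊑_ : Str → Str → Set
τ ⊑ τ' = ∃ λ ρ → τ ++ ρ ≡ τ'

data PR : ℕ → Set where
  zer  : ∀ {n} → PR n
  succ : PR 1
  proj : ∀ {n} → Fin n → PR n
  comp : ∀ {m n} → PR m → Vec (PR n) m → PR n
  prec : ∀ {n} → PR n → PR (suc (suc n)) → PR (suc n)

mutual
  evalPR : ∀ {n} → PR n → Vec ℕ n → ℕ
  evalPR zer xs = 0
  evalPR succ (x ∷ []) = suc x
  evalPR (proj i) xs = lookup xs i
  evalPR (comp f gs) xs = evalPR f (evalAll gs xs)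
  evalPR (prec f g) (k ∷ xs) = evalRec f g k xs

  evalAll : ∀ {m n} → Vec (PR n) m → Vec ℕ n → Vec ℕ m
  evalAll [] xs = []
  evalAll (g ∷ gs) xs = evalPR g xs ∷ evalAll gs xs

  evalRec : ∀ {n} → PR n → PR (suc (suc n)) → ℕ → Vec ℕ n → ℕ
  evalRec f g zero xs = evalPR f xs
  evalRec f g (suc k) xs = evalPR g (k ∷ evalRec f g k xs ∷ xs)

IsPR : (ℕ → ℕ) → Set
IsPR f = Σ (PR 1) λ p → ∀ x → evalPR p (x ∷ []) ≡ f x

-- strings: bijective base-2 numeration
encS : Str → ℕ
encS [] = 0
encS (false ∷ s) = 1 + 2 * encS s
encS (true ∷ s) = 2 + 2 * encS s

encL : List ℕ → ℕ
encL [] = 0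
encL (x ∷ xs) = 2 ^ x * (1 + 2 * encL xs)

-- finite sets of strings (given by a list enumerating them)
encSet : List Str → ℕ
encSet G = encL (map encS G)

IsPRStr : (Str → Str) → Set
IsPRStr M = Σ (PR 1) λ p → ∀ σ → evalPR p (encS σ ∷ []) ≡ encS (M σ)

IsPRSeq : (ℕ → List Str) → Set
IsPRSeq G = Σ (PR 1) λ p → ∀ n → evalPR p (n ∷ []) ≡ encSet (G n)

_∈[_] : Real → List Str → Set
X ∈[ G ] = Any (λ σ → X ↾ length σ ≡ σ) G

isPrefix : Str → Str → Bool
isPrefix [] τ = true
isPrefix (b ∷ σ) [] = false
isPrefix (true ∷ σ) (true ∷ τ) = isPrefix σ τ
isPrefix (false ∷ σ) (false ∷ τ) = isPrefix σ τ
isPrefix (true ∷ σ) (false ∷ τ) = false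
isPrefix (false ∷ σ) (true ∷ τ) = false

allStrings : ℕ → List Str
allStrings zero = [] ∷ []
allStrings (suc L) = map (false ∷_) (allStrings L) ++ map (true ∷_) (allStrings L)

maxLen : List Str → ℕ
maxLen = foldr (λ σ m → length σ ⊔ m) 0

-- number of strings of length maxLen G lying in [G];
-- μ([G]) = countCovered G / 2^(maxLen G)
countCovered : List Str → ℕ
countCovered G = length (filterᵇ (λ τ → any (λ σ → isPrefix σ τ) G) (allStrings (maxLen G)))

μ[_]≤2^-_ : List Str → ℕ → Set
μ[ G ]≤2^- n = countCovered G * 2 ^ n ≤ 2 ^ maxLen G

IsPRTest : (ℕ → List Str) → Set
IsPRTest G = IsPRSeq G × (∀ n → μ[ G n ]≤2^- n)

-- "for every primitive recursive test there is n with X ∉ U_n"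
-- (existence read classically, i.e. double negated)
MLBPRandom : Real → Set
MLBPRandom X = ∀ G → IsPRTest G → ¬ ¬ (∃ λ n → ¬ (X ∈[ G n ]))

-- C_M(X↾f(c)) ≤ f(c) − c for all c, with f primitive recursive
PRCompressedBy : (Str → Str) → Real → Set
PRCompressedBy M X =
  Σ (ℕ → ℕ) λ f → IsPR f ×
    (∀ c → ∃ λ σ → (M σ ≡ X ↾ f c) × (length σ + c ≤ f c))

KolmogorovBPRandom : Real → Set
KolmogorovBPRandom X = ∀ M → IsPRStr M → ¬ PRCompressedBy M X

IsOrder : (ℕ → ℕ) → Set
IsOrder h = (∀ m n → m ≤ n → h m ≤ h n) × (∀ k → ∃ λ n → k ≤ h n)

IsQuickProcessBP : (Str → Str) → Set
IsQuickProcessBP M =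
  IsPRStr M ×
  (∀ τ τ' → τ ⊑ τ' → M τ ⊑ M τ') ×
  (Σ (ℕ → ℕ) λ h → IsPR h × IsOrder h × (∀ τ → h (length τ) ≤ length (M τ)))

QuickProcessBPRandom : Real → Set
QuickProcessBPRandom X = ∀ M → IsQuickProcessBP M → ¬ PRCompressedBy M X

module Submission where

-- ML ⇒ K.  If M compresses X at the lengths f c, then the M-outputs of length
-- L = f (c + 1) of all programs of length ≤ L − (c + 1) form a clopen set of
-- measure ≤ 2^−c containing X; these sets form a primitive recursive test.
--
-- K ⇒ ML.  Let the test G capture X (membership in a clopen set is decidable,
-- so the double negation is harmless).  With L = maxLen G (2c + 1), the string
-- X ↾ L is one of at most 2^(L − 2c − 1) strings of length L covered by
-- G (2c + 1), so it is determined by c and its rank r among them; the pair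
-- code 2^c (2r + 1) − 1 is a description of X ↾ L of length ≤ L − c.
--
-- K ⇔ QP.  A quick process machine is a machine.  Conversely, a compressing M
-- is turned into a quick process machine that reads padded M-programs block
-- by block and appends their outputs, so that it compresses X as well.

open import Defs
open import Data.Bool using (Bool; true; false; _∨_)
open import Data.Bool.ListAction using (any)
open import Data.Bool.Properties using () renaming (_≟_ to _≟ᵇ_)
open import Data.Empty using (⊥-elim)
open import Data.Fin using (Fin) renaming (zero to fzero; suc to fsuc)
open import Data.List
  using (List; []; _∷_; _++_; length; map; foldr; take; drop; replicate; filterᵇ)
open import Data.List.Properties
  using ( length-take; length-++; length-map; length-replicate; take++drop≡id
        ; ++-assoc; ++-identityʳ; drop-[]; drop-map; ≡-dec)
open import Data.List.Relation.Unary.All using (All; []; _∷_)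
open import Data.List.Relation.Unary.Any using (Any; here; there; any?)
open import Data.Nat
  using (ℕ; zero; suc; _+_; _*_; _∸_; _^_; _≤_; _<_; _⊓_; _⊔_; pred; z≤n; s≤s; NonZero; _≤?_; _<?_)
open import Data.Nat.Properties
open import Data.Nat.ListAction using (sum)
open import Data.Nat.Tactic.RingSolver using (solve-∀)
open import Data.Product using (∃; _×_; _,_; proj₁; proj₂)
open import Data.Sum using (_⊎_; inj₁; inj₂)
open import Data.Vec using (Vec; []; _∷_; lookup; tabulate)
open import Data.Vec.Properties using (tabulate∘lookup)
open import Function.Bundles using (_⇔_; mk⇔)
open import Relation.Binary.PropositionalEquality
open import Relation.Binary.Definitions using (tri<; tri≈; tri>)
open import Relation.Nullary using (¬_; Dec; yes; no)

isZero : ℕ → ℕ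
isZero zero = 1
isZero (suc _) = 0

infixl 6 _⊕_ _⊝_
infixl 7 _⊗_

-- Arithmetic expressions in n variables with iteration (rec) and calls of closed
-- expressions; compile turns them into PR codes, so every PR function below is
-- given as an Expr together with a correctness lemma for its semantics ⟦_⟧.
data Expr (n : ℕ) : Set where
  var         : Fin n → Expr n
  lit         : ℕ → Expr n
  _⊕_ _⊗_ _⊝_ : Expr n → Expr n → Expr n
  pow2        : Expr n → Expr n
  is0         : Expr n → Expr n
  apply       : PR 1 → Expr n → Expr n
  rec         : Expr n → Expr (suc (suc n)) → Expr n → Expr n
  call        : ∀ {m} → Expr m → Vec (Expr n) m → Expr n

mutual
  ⟦_⟧ : ∀ {n} → Expr n → Vec ℕ n → ℕ
  ⟦ var i ⟧ xs = lookup xs i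
  ⟦ lit k ⟧ xs = k
  ⟦ a ⊕ b ⟧ xs = ⟦ a ⟧ xs + ⟦ b ⟧ xs
  ⟦ a ⊗ b ⟧ xs = ⟦ a ⟧ xs * ⟦ b ⟧ xs
  ⟦ a ⊝ b ⟧ xs = ⟦ a ⟧ xs ∸ ⟦ b ⟧ xs
  ⟦ pow2 a ⟧ xs = 2 ^ ⟦ a ⟧ xs
  ⟦ is0 a ⟧ xs = isZero (⟦ a ⟧ xs)
  ⟦ apply p a ⟧ xs = evalPR p (⟦ a ⟧ xs ∷ [])
  ⟦ rec b s c ⟧ xs = iterate b s (⟦ c ⟧ xs) xs
  ⟦ call f as ⟧ xs = ⟦ f ⟧ (⟦ as ⟧* xs)

  ⟦_⟧* : ∀ {n m} → Vec (Expr n) m → Vec ℕ n → Vec ℕ m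
  ⟦ [] ⟧* xs = []
  ⟦ a ∷ as ⟧* xs = ⟦ a ⟧ xs ∷ ⟦ as ⟧* xs

  -- the step s sees (j ∷ value at j ∷ xs), as in evalRec
  iterate : ∀ {n} → Expr n → Expr (suc (suc n)) → ℕ → Vec ℕ n → ℕ
  iterate b s zero xs = ⟦ b ⟧ xs
  iterate b s (suc j) xs = ⟦ s ⟧ (j ∷ iterate b s j xs ∷ xs)

x₀ : ∀ {n} → Expr (suc n)
x₀ = var fzero

x₁ : ∀ {n} → Expr (suc (suc n))
x₁ = var (fsuc fzero)

x₂ : ∀ {n} → Expr (suc (suc (suc n)))
x₂ = var (fsuc (fsuc fzero))

x₃ : ∀ {n} → Expr (suc (suc (suc (suc n))))
x₃ = var (fsuc (fsuc (fsuc fzero)))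

module PRPrograms where

  constPR : ∀ {n} → ℕ → PR n
  constPR zero = zer
  constPR (suc k) = comp succ (constPR k ∷ [])

  constPR-correct : ∀ {n} k (xs : Vec ℕ n) → evalPR (constPR k) xs ≡ k
  constPR-correct zero xs = refl
  constPR-correct (suc k) xs = cong suc (constPR-correct k xs)

  addPR : PR 2
  addPR = prec (proj fzero) (comp succ (proj (fsuc fzero) ∷ []))

  addPR-correct : ∀ a b → evalPR addPR (a ∷ b ∷ []) ≡ a + b
  addPR-correct zero b = refl
  addPR-correct (suc a) b = cong suc (addPR-correct a b)

  mulPR : PR 2
  mulPR = prec zer (comp addPR (proj (fsuc fzero) ∷ proj (fsuc (fsuc fzero)) ∷ []))

  mulPR-correct : ∀ a b → evalPR mulPR (a ∷ b ∷ []) ≡ a * b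
  mulPR-correct zero b = refl
  mulPR-correct (suc a) b
    rewrite addPR-correct (evalPR mulPR (a ∷ b ∷ [])) b | mulPR-correct a b = +-comm (a * b) b

  predPR : PR 1
  predPR = prec zer (proj fzero)

  predPR-correct : ∀ a → evalPR predPR (a ∷ []) ≡ pred a
  predPR-correct zero = refl
  predPR-correct (suc a) = refl

  -- primitive recursion runs on the first argument, so ∸ is built with its arguments swapped
  monusPR : PR 2
  monusPR = comp subtractFrom (proj (fsuc fzero) ∷ proj fzero ∷ [])
    where
    subtractFrom : PR 2
    subtractFrom = prec (proj fzero) (comp predPR (proj (fsuc fzero) ∷ []))

  monusPR-correct : ∀ a b → evalPR monusPR (a ∷ b ∷ []) ≡ a ∸ b
  monusPR-correct a zero = refl
  monusPR-correct a (suc b)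
    rewrite predPR-correct (evalPR monusPR (a ∷ b ∷ [])) | monusPR-correct a b = pred[m∸n]≡m∸[1+n] a b

  pow2PR : PR 1
  pow2PR = prec (constPR 1) (comp addPR (proj (fsuc fzero) ∷ proj (fsuc fzero) ∷ []))

  pow2PR-correct : ∀ a → evalPR pow2PR (a ∷ []) ≡ 2 ^ a
  pow2PR-correct zero = refl
  pow2PR-correct (suc a)
    rewrite addPR-correct (evalPR pow2PR (a ∷ [])) (evalPR pow2PR (a ∷ [])) | pow2PR-correct a =
    cong (2 ^ a +_) (sym (+-identityʳ (2 ^ a)))

  isZeroPR : PR 1
  isZeroPR = prec (constPR 1) zer

  isZeroPR-correct : ∀ a → evalPR isZeroPR (a ∷ []) ≡ isZero a
  isZeroPR-correct zero = refl
  isZeroPR-correct (suc a) = refl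

  identities : ∀ {n} → Vec (PR n) n
  identities = tabulate proj

  evalAll-tabulate : ∀ {m n} (f : Fin m → PR n) xs →
                     evalAll (tabulate f) xs ≡ tabulate (λ i → evalPR (f i) xs)
  evalAll-tabulate {zero} f xs = refl
  evalAll-tabulate {suc m} f xs = cong (evalPR (f fzero) xs ∷_) (evalAll-tabulate (λ i → f (fsuc i)) xs)

  evalAll-identities : ∀ {n} (xs : Vec ℕ n) → evalAll identities xs ≡ xs
  evalAll-identities xs = trans (evalAll-tabulate proj xs) (tabulate∘lookup xs)

open PRPrograms

mutual
  compile : ∀ {n} → Expr n → PR n
  compile (var i) = proj i
  compile (lit k) = constPR k
  compile (a ⊕ b) = comp addPR (compile a ∷ compile b ∷ [])
  compile (a ⊗ b) = comp mulPR (compile a ∷ compile b ∷ [])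
  compile (a ⊝ b) = comp monusPR (compile a ∷ compile b ∷ [])
  compile (pow2 a) = comp pow2PR (compile a ∷ [])
  compile (is0 a) = comp isZeroPR (compile a ∷ [])
  compile (apply p a) = comp p (compile a ∷ [])
  compile (rec b s c) = comp (prec (compile b) (compile s)) (compile c ∷ identities)
  compile (call f as) = comp (compile f) (compile* as)

  compile* : ∀ {n m} → Vec (Expr n) m → Vec (PR n) m
  compile* [] = []
  compile* (a ∷ as) = compile a ∷ compile* as

mutual
  compile-correct : ∀ {n} (e : Expr n) xs → evalPR (compile e) xs ≡ ⟦ e ⟧ xs
  compile-correct (var i) xs = refl
  compile-correct (lit k) xs = constPR-correct k xs
  compile-correct (a ⊕ b) xs
    rewrite compile-correct a xs | compile-correct b xs = addPR-correct (⟦ a ⟧ xs) (⟦ b ⟧ xs)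
  compile-correct (a ⊗ b) xs
    rewrite compile-correct a xs | compile-correct b xs = mulPR-correct (⟦ a ⟧ xs) (⟦ b ⟧ xs)
  compile-correct (a ⊝ b) xs
    rewrite compile-correct a xs | compile-correct b xs = monusPR-correct (⟦ a ⟧ xs) (⟦ b ⟧ xs)
  compile-correct (pow2 a) xs rewrite compile-correct a xs = pow2PR-correct (⟦ a ⟧ xs)
  compile-correct (is0 a) xs rewrite compile-correct a xs = isZeroPR-correct (⟦ a ⟧ xs)
  compile-correct (apply p a) xs rewrite compile-correct a xs = refl
  compile-correct (rec b s c) xs
    rewrite evalAll-identities xs | compile-correct c xs = compile-iterate b s (⟦ c ⟧ xs) xs
  compile-correct (call f as) xs rewrite compile*-correct as xs = compile-correct f _

  compile*-correct : ∀ {n m} (as : Vec (Expr n) m) xs → evalAll (compile* as) xs ≡ ⟦ as ⟧* xs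
  compile*-correct [] xs = refl
  compile*-correct (a ∷ as) xs = cong₂ _∷_ (compile-correct a xs) (compile*-correct as xs)

  compile-iterate : ∀ {n} (b : Expr n) s j xs → evalRec (compile b) (compile s) j xs ≡ iterate b s j xs
  compile-iterate b s zero xs = compile-correct b xs
  compile-iterate b s (suc j) xs rewrite compile-iterate b s j xs = compile-correct s _

Expr⇒IsPR : (e : Expr 1) {f : ℕ → ℕ} → (∀ x → ⟦ e ⟧ (x ∷ []) ≡ f x) → IsPR f
Expr⇒IsPR e e≗f = compile e , λ x → trans (compile-correct e (x ∷ [])) (e≗f x)

Expr⇒IsPRStr : (e : Expr 1) {M : Str → Str} → (∀ σ → ⟦ e ⟧ (encS σ ∷ []) ≡ encS (M σ)) → IsPRStr M
Expr⇒IsPRStr e e≗M = compile e , λ σ → trans (compile-correct e (encS σ ∷ [])) (e≗M σ)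

isPositive : ℕ → ℕ
isPositive a = isZero (isZero a)

isPositive-pos : ∀ a → 1 ≤ a → isPositive a ≡ 1
isPositive-pos (suc a) _ = refl

isZero-∸-≤ : ∀ {a b} → a ≤ b → isZero (a ∸ b) ≡ 1
isZero-∸-≤ a≤b rewrite m≤n⇒m∸n≡0 a≤b = refl

isZero-∸-> : ∀ {a b} → b < a → isZero (a ∸ b) ≡ 0
isZero-∸-> {suc a} {zero} _ = refl
isZero-∸-> {suc a} {suc b} (s≤s b<a) = isZero-∸-> b<a

eqIndicator : ℕ → ℕ → ℕ
eqIndicator a b = isZero (a ∸ b) * isZero (b ∸ a)

eqIndicator-refl : ∀ a → eqIndicator a a ≡ 1
eqIndicator-refl a rewrite n∸n≡0 a = refl

eqIndicator-≢ : ∀ a b → a ≢ b → eqIndicator a b ≡ 0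
eqIndicator-≢ a b a≢b with <-cmp a b
... | tri< a<b _ _ rewrite isZero-∸-> a<b = *-zeroʳ (isZero (a ∸ b))
... | tri≈ _ a≡b _ = ⊥-elim (a≢b a≡b)
... | tri> _ _ b<a rewrite isZero-∸-> b<a = refl

isZero-*-≢0 : ∀ a b → isZero a * b ≢ 0 → a ≡ 0 × b ≢ 0
isZero-*-≢0 zero b ≢0 = refl , λ b≡0 → ≢0 (trans (+-identityʳ b) b≡0)
isZero-*-≢0 (suc a) b ≢0 = ⊥-elim (≢0 refl)

isZero-≢0 : ∀ a → isZero a ≢ 0 → a ≡ 0
isZero-≢0 zero _ = refl
isZero-≢0 (suc a) ≢0 = ⊥-elim (≢0 refl)

eqIndicator-≢0 : ∀ a b → eqIndicator a b ≢ 0 → a ≡ b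
eqIndicator-≢0 a b ≢0 with isZero-*-≢0 (a ∸ b) _ ≢0
... | a∸b≡0 , ≢0′ = ≤-antisym (m∸n≡0⇒m≤n a∸b≡0) (m∸n≡0⇒m≤n (isZero-≢0 (b ∸ a) ≢0′))

mono-by-step : ∀ {A : Set} (_R_ : A → A → Set) → (∀ {x} → x R x) → (∀ {x y z} → x R y → y R z → x R z) →
               (g : ℕ → A) → (∀ n → g n R g (suc n)) → ∀ {m n} → m ≤ n → g m R g n
mono-by-step _R_ refl′ trans′ g step {n = zero} z≤n = refl′
mono-by-step _R_ refl′ trans′ g step {m} {suc n} m≤1+n with m≤n⇒m<n∨m≡n m≤1+n
... | inj₁ (s≤s m≤n) = trans′ (mono-by-step _R_ refl′ trans′ g step m≤n) (step n)
... | inj₂ refl = refl′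

mono-ℕ-by-step : (g : ℕ → ℕ) → (∀ n → g n ≤ g (suc n)) → ∀ {m n} → m ≤ n → g m ≤ g n
mono-ℕ-by-step = mono-by-step _≤_ ≤-refl ≤-trans

sumBelow : (ℕ → ℕ) → ℕ → ℕ
sumBelow g zero = 0
sumBelow g (suc n) = sumBelow g n + g n

sumBelow-cong : ∀ {f g} n → (∀ i → i < n → f i ≡ g i) → sumBelow f n ≡ sumBelow g n
sumBelow-cong zero f≗g = refl
sumBelow-cong (suc n) f≗g =
  cong₂ _+_ (sumBelow-cong n (λ i i<n → f≗g i (m≤n⇒m≤1+n i<n))) (f≗g n ≤-refl)

sumBelow-zero : ∀ g n → (∀ i → i < n → g i ≡ 0) → sumBelow g n ≡ 0
sumBelow-zero g zero g≗0 = refl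
sumBelow-zero g (suc n) g≗0
  rewrite sumBelow-zero g n (λ i i<n → g≗0 i (m≤n⇒m≤1+n i<n)) = g≗0 n ≤-refl

sumBelow-pos : ∀ g n i → i < n → 1 ≤ g i → 1 ≤ sumBelow g n
sumBelow-pos g (suc n) i (s≤s i≤n) pos with m≤n⇒m<n∨m≡n i≤n
... | inj₁ i<n = ≤-trans (sumBelow-pos g n i i<n pos) (m≤m+n _ _)
... | inj₂ refl = ≤-trans pos (m≤n+m _ _)

sumBelow-monoʳ : ∀ g {a b} → a ≤ b → sumBelow g a ≤ sumBelow g b
sumBelow-monoʳ g = mono-ℕ-by-step (sumBelow g) (λ n → m≤m+n (sumBelow g n) (g n))

sumBelow-threshold : ∀ g t → (∀ q → q < t → g q ≡ 1) → (∀ q → t ≤ q → g q ≡ 0) →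
                     ∀ n → sumBelow g n ≡ n ⊓ t
sumBelow-threshold g t below above zero = refl
sumBelow-threshold g t below above (suc n)
  rewrite sumBelow-threshold g t below above n with n <? t
... | yes n<t rewrite below n n<t | m≤n⇒m⊓n≡m (<⇒≤ n<t) | m≤n⇒m⊓n≡m n<t = +-comm n 1
... | no n≮t
  rewrite above n (≮⇒≥ n≮t) | m≥n⇒m⊓n≡n (≮⇒≥ n≮t) | m≥n⇒m⊓n≡n (m≤n⇒m≤1+n (≮⇒≥ n≮t)) = +-identityʳ t

sumBelow-threshold-≤ : ∀ g t n → (∀ q → q < t → g q ≡ 1) → (∀ q → t ≤ q → g q ≡ 0) →
                       t ≤ n → sumBelow g n ≡ t
sumBelow-threshold-≤ g t n below above t≤n =
  trans (sumBelow-threshold g t below above n) (m≥n⇒m⊓n≡n t≤n)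

sumBelow-single : ∀ g N e₀ → e₀ < N → (∀ e → e < N → e ≢ e₀ → g e ≡ 0) → sumBelow g N ≡ g e₀
sumBelow-single g (suc N) e₀ (s≤s e₀≤N) others with m≤n⇒m<n∨m≡n e₀≤N
... | inj₁ e₀<N
  rewrite sumBelow-single g N e₀ e₀<N (λ e e<N → others e (m≤n⇒m≤1+n e<N))
        | others N ≤-refl (λ N≡e₀ → <-irrefl (sym N≡e₀) e₀<N) = +-identityʳ (g e₀)
... | inj₂ refl
  rewrite sumBelow-zero g N (λ e e<N → others e (m≤n⇒m≤1+n e<N) (λ e≡N → <-irrefl e≡N e<N)) = refl

sumBelow-suc : ∀ g n → sumBelow g (suc n) ≡ g 0 + sumBelow (λ i → g (suc i)) n
sumBelow-suc g zero = +-comm 0 (g 0)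
sumBelow-suc g (suc n) rewrite sumBelow-suc g n = +-assoc (g 0) _ _

sumBelow-even-odd : ∀ g K →
  sumBelow g (2 * K) ≡ sumBelow (λ e → g (2 * e)) K + sumBelow (λ e → g (1 + 2 * e)) K
sumBelow-even-odd g zero = refl
sumBelow-even-odd g (suc K) = begin
  sumBelow g (2 * suc K)
    ≡⟨ cong (sumBelow g) (double-suc K) ⟩
  sumBelow g (2 * K) + g (2 * K) + g (1 + 2 * K)
    ≡⟨ cong (λ s → s + g (2 * K) + g (1 + 2 * K)) (sumBelow-even-odd g K) ⟩
  Σeven + Σodd + g (2 * K) + g (1 + 2 * K)
    ≡⟨ interchange Σeven Σodd (g (2 * K)) (g (1 + 2 * K)) ⟩
  (Σeven + g (2 * K)) + (Σodd + g (1 + 2 * K)) ∎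
  where
  open ≡-Reasoning
  Σeven = sumBelow (λ e → g (2 * e)) K
  Σodd = sumBelow (λ e → g (1 + 2 * e)) K
  double-suc : ∀ K → 2 * suc K ≡ suc (suc (2 * K))
  double-suc = solve-∀
  interchange : ∀ a b c d → a + b + c + d ≡ a + c + (b + d)
  interchange = solve-∀

maxBelow : (ℕ → ℕ) → ℕ → ℕ
maxBelow g zero = 0
maxBelow g (suc n) = maxBelow g n ⊔ g n

maxBelow-zero : ∀ g n → (∀ i → i < n → g i ≡ 0) → maxBelow g n ≡ 0
maxBelow-zero g zero g≗0 = refl
maxBelow-zero g (suc n) g≗0
  rewrite maxBelow-zero g n (λ i i<n → g≗0 i (m≤n⇒m≤1+n i<n)) = g≗0 n ≤-refl

maxBelow-suc : ∀ g n → maxBelow g (suc n) ≡ g 0 ⊔ maxBelow (λ i → g (suc i)) n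
maxBelow-suc g zero = ⊔-comm 0 (g 0)
maxBelow-suc g (suc n) rewrite maxBelow-suc g n = ⊔-assoc (g 0) _ _

m+[n∸m]≡m⊔n : ∀ m n → m + (n ∸ m) ≡ m ⊔ n
m+[n∸m]≡m⊔n m n with m ≤? n
... | yes m≤n = trans (m+[n∸m]≡n m≤n) (sym (m≤n⇒m⊔n≡n m≤n))
... | no m≰n rewrite m≤n⇒m∸n≡0 (<⇒≤ (≰⇒> m≰n)) =
  trans (+-identityʳ m) (sym (m≥n⇒m⊔n≡m (<⇒≤ (≰⇒> m≰n))))

tabulate-⟦⟧* : ∀ {n m} (f : Fin m → Expr n) xs → ⟦ tabulate f ⟧* xs ≡ tabulate (λ i → ⟦ f i ⟧ xs)
tabulate-⟦⟧* {m = zero} f xs = refl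
tabulate-⟦⟧* {m = suc m} f xs = cong (⟦ f fzero ⟧ xs ∷_) (tabulate-⟦⟧* (λ i → f (fsuc i)) xs)

weaken₂ : ∀ {n} → Vec (Expr (suc (suc n))) n
weaken₂ = tabulate (λ i → var (fsuc (fsuc i)))

weaken₂-correct : ∀ {n} j a (xs : Vec ℕ n) → ⟦ weaken₂ ⟧* (j ∷ a ∷ xs) ≡ xs
weaken₂-correct j a xs = trans (tabulate-⟦⟧* _ (j ∷ a ∷ xs)) (tabulate∘lookup xs)

sumE : ∀ {n} → Expr (suc n) → Expr n → Expr n
sumE body c = rec (lit 0) (x₁ ⊕ call body (x₀ ∷ weaken₂)) c

sumE-iterate : ∀ {n} (body : Expr (suc n)) k xs →
  iterate (lit 0) (x₁ ⊕ call body (x₀ ∷ weaken₂)) k xs ≡ sumBelow (λ i → ⟦ body ⟧ (i ∷ xs)) k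
sumE-iterate body zero xs = refl
sumE-iterate body (suc k) xs
  rewrite weaken₂-correct k (iterate (lit 0) (x₁ ⊕ call body (x₀ ∷ weaken₂)) k xs) xs
        | sumE-iterate body k xs = refl

sumE-correct : ∀ {n} (body : Expr (suc n)) c xs →
               ⟦ sumE body c ⟧ xs ≡ sumBelow (λ i → ⟦ body ⟧ (i ∷ xs)) (⟦ c ⟧ xs)
sumE-correct body c xs = sumE-iterate body (⟦ c ⟧ xs) xs

leqE : ∀ {n} → Expr n → Expr n → Expr n
leqE a b = is0 (a ⊝ b)

eqE : ∀ {n} → Expr n → Expr n → Expr n
eqE a b = is0 (a ⊝ b) ⊗ is0 (b ⊝ a)

n<2^n : ∀ n → n < 2 ^ n
n<2^n zero = s≤s z≤n
n<2^n (suc n) = ≤-trans (+-mono-≤ (m^n>0 2 n) (n<2^n n)) (≤-reflexive (cong (2 ^ n +_) (sym (+-identityʳ _))))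

2^-cancel-< : ∀ {a b} → 2 ^ a < 2 ^ b → a < b
2^-cancel-< {a} {b} 2^a<2^b with a <? b
... | yes a<b = a<b
... | no a≮b = ⊥-elim (<⇒≱ 2^a<2^b (^-monoʳ-≤ 2 (≮⇒≥ a≮b)))

2^-nonZero : ∀ x → NonZero (2 ^ x)
2^-nonZero x = m^n≢0 2 x

incS : Str → Str
incS [] = false ∷ []
incS (false ∷ s) = true ∷ s
incS (true ∷ s) = false ∷ incS s

encS-incS : ∀ s → encS (incS s) ≡ suc (encS s)
encS-incS [] = refl
encS-incS (false ∷ s) = refl
encS-incS (true ∷ s) rewrite encS-incS s = carry (encS s)
  where
  carry : ∀ e → 1 + 2 * suc e ≡ suc (2 + 2 * e)
  carry = solve-∀

decS : ℕ → Str
decS zero = []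
decS (suc m) = incS (decS m)

encS-decS : ∀ m → encS (decS m) ≡ m
encS-decS zero = refl
encS-decS (suc m) rewrite encS-incS (decS m) = cong suc (encS-decS m)

encS-injective : ∀ s t → encS s ≡ encS t → s ≡ t
encS-injective [] [] _ = refl
encS-injective [] (false ∷ t) ()
encS-injective [] (true ∷ t) ()
encS-injective (false ∷ s) [] ()
encS-injective (true ∷ s) [] ()
encS-injective (false ∷ s) (false ∷ t) eq =
  cong (false ∷_) (encS-injective s t (*-cancelˡ-≡ _ _ 2 (suc-injective eq)))
encS-injective (true ∷ s) (true ∷ t) eq =
  cong (true ∷_) (encS-injective s t (*-cancelˡ-≡ _ _ 2 (suc-injective (suc-injective eq))))
encS-injective (false ∷ s) (true ∷ t) eq = ⊥-elim (even≢odd (encS s) (encS t) (suc-injective eq))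
encS-injective (true ∷ s) (false ∷ t) eq = ⊥-elim (even≢odd (encS t) (encS s) (sym (suc-injective eq)))

decS-encS : ∀ s → decS (encS s) ≡ s
decS-encS s = encS-injective _ _ (encS-decS (encS s))

decS-odd : ∀ m → decS (1 + 2 * m) ≡ false ∷ decS m
decS-odd m = encS-injective _ _ (trans (encS-decS (1 + 2 * m)) (cong (λ n → 1 + 2 * n) (sym (encS-decS m))))

decS-even : ∀ m → decS (2 + 2 * m) ≡ true ∷ decS m
decS-even m = encS-injective _ _ (trans (encS-decS (2 + 2 * m)) (cong (λ n → 2 + 2 * n) (sym (encS-decS m))))

encS-++ : ∀ s t → encS (s ++ t) ≡ encS s + 2 ^ length s * encS t
encS-++ [] t = sym (+-identityʳ (encS t))
encS-++ (false ∷ s) t rewrite encS-++ s t = distrib (encS s) (encS t) (2 ^ length s)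
  where
  distrib : ∀ a b p → 1 + 2 * (a + p * b) ≡ 1 + 2 * a + (2 * p) * b
  distrib = solve-∀
encS-++ (true ∷ s) t rewrite encS-++ s t = distrib (encS s) (encS t) (2 ^ length s)
  where
  distrib : ∀ a b p → 2 + 2 * (a + p * b) ≡ 2 + 2 * a + (2 * p) * b
  distrib = solve-∀

encS-replicate-false : ∀ L → encS (replicate L false) ≡ 2 ^ L ∸ 1
encS-replicate-false zero = refl
encS-replicate-false (suc L) rewrite encS-replicate-false L = shift (2 ^ L) (m^n>0 2 L)
  where
  shift : ∀ q → 1 ≤ q → 1 + 2 * (q ∸ 1) ≡ 2 * q ∸ 1
  shift (suc q) _ = cong (_∸ 1) (distrib q)
    where
    distrib : ∀ q → 2 + 2 * q ≡ 2 * suc q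
    distrib = solve-∀

-- Strings of length L are exactly the codes in [2^L − 1, 2^(L+1) − 2].
2^length≤1+encS : ∀ s → 2 ^ length s ≤ suc (encS s)
2^length≤1+encS [] = ≤-refl
2^length≤1+encS (false ∷ s) = ≤-trans (*-monoʳ-≤ 2 (2^length≤1+encS s)) (≤-reflexive (distrib (encS s)))
  where
  distrib : ∀ e → 2 * suc e ≡ suc (1 + 2 * e)
  distrib = solve-∀
2^length≤1+encS (true ∷ s) =
  ≤-trans (*-monoʳ-≤ 2 (2^length≤1+encS s)) (≤-trans (≤-reflexive (distrib (encS s))) (n≤1+n _))
  where
  distrib : ∀ e → 2 * suc e ≡ 2 + 2 * e
  distrib = solve-∀

2+encS≤2^1+length : ∀ s → 2 + encS s ≤ 2 ^ suc (length s)
2+encS≤2^1+length [] = ≤-refl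
2+encS≤2^1+length (false ∷ s) =
  ≤-trans (n≤1+n _) (≤-trans (≤-reflexive (distrib (encS s))) (*-monoʳ-≤ 2 (2+encS≤2^1+length s)))
  where
  distrib : ∀ e → 3 + (1 + 2 * e) ≡ 2 * (2 + e)
  distrib = solve-∀
2+encS≤2^1+length (true ∷ s) = ≤-trans (≤-reflexive (distrib (encS s))) (*-monoʳ-≤ 2 (2+encS≤2^1+length s))
  where
  distrib : ∀ e → 2 + (2 + 2 * e) ≡ 2 * (2 + e)
  distrib = solve-∀

length≤encS : ∀ s → length s ≤ encS s
length≤encS s = ≤-pred (≤-trans (n<2^n (length s)) (2^length≤1+encS s))

length-decS : ∀ {m L} → 2 ^ L ≤ suc m → suc m < 2 ^ suc L → length (decS m) ≡ L
length-decS {m} {L} lo hi = ≤-antisym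
  (≤-pred (2^-cancel-< (≤-trans (s≤s lower) hi)))
  (≤-pred (2^-cancel-< (≤-trans (s≤s lo) upper)))
  where
  s = decS m
  lower : 2 ^ length s ≤ suc m
  lower = subst (λ z → 2 ^ length s ≤ suc z) (encS-decS m) (2^length≤1+encS s)
  upper : 2 + m ≤ 2 ^ suc (length s)
  upper = subst (λ z → 2 + z ≤ 2 ^ suc (length s)) (encS-decS m) (2+encS≤2^1+length s)

padding : ℕ → ℕ
padding d = 2 ^ suc d ∸ 1

length-pad : ∀ σ d → length σ ≤ d → length (decS (encS σ + padding d)) ≡ suc d
length-pad σ d |σ|≤d = length-decS lo hi
  where
  e = encS σ
  P = 2 ^ suc d
  suc-pad : suc (e + padding d) ≡ e + P
  suc-pad = trans (sym (+-suc e (P ∸ 1))) (cong (e +_) (trans (+-comm 1 (P ∸ 1)) (m∸n+n≡m (m^n>0 2 (suc d)))))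
  lo : P ≤ suc (e + padding d)
  lo = subst (P ≤_) (sym suc-pad) (m≤n+m P e)
  2+e≤P : 2 + e ≤ P
  2+e≤P = ≤-trans (2+encS≤2^1+length σ) (^-monoʳ-≤ 2 (s≤s |σ|≤d))
  hi : suc (e + padding d) < 2 ^ suc (suc d)
  hi = subst (_< 2 ^ suc (suc d)) (sym suc-pad)
         (≤-trans (+-monoˡ-≤ P (≤-trans (n≤1+n _) 2+e≤P))
                  (≤-reflexive (cong (P +_) (sym (+-identityʳ P)))))

encS<padding : ∀ σ d → length σ ≤ d → encS σ < padding d
encS<padding σ d |σ|≤d = ∸-monoˡ-≤ 1 (≤-trans (2+encS≤2^1+length σ) (^-monoʳ-≤ 2 (s≤s |σ|≤d)))

encS-offset : ∀ τ {L} → length τ ≡ L →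
              2 ^ L ∸ 1 + (encS τ ∸ (2 ^ L ∸ 1)) ≡ encS τ × encS τ ∸ (2 ^ L ∸ 1) < 2 ^ L
encS-offset τ {L} refl =
  m+[n∸m]≡n first≤ ,
  ≤-trans (≤-reflexive (sym (+-∸-assoc 1 first≤)))
          (≤-trans (∸-monoˡ-≤ (P ∸ 1) last<) (≤-reflexive (width P (m^n>0 2 L))))
  where
  P = 2 ^ L
  first≤ : P ∸ 1 ≤ encS τ
  first≤ = ∸-monoˡ-≤ 1 (2^length≤1+encS τ)
  last< : suc (encS τ) ≤ 2 ^ suc L ∸ 1
  last< = ∸-monoˡ-≤ 1 (2+encS≤2^1+length τ)
  width : ∀ P → 1 ≤ P → 2 * P ∸ 1 ∸ (P ∸ 1) ≡ P
  width (suc P) _ rewrite +-suc P (P + 0) | +-identityʳ P = m+n∸n≡m (suc P) P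

tailE : Expr 1
tailE = sumE (leqE (lit 3 ⊕ lit 2 ⊗ x₀) x₁) x₀

-- For m = b + 2e with b ∈ {1, 2}, the q < m with 3 + 2q ≤ m are exactly the q < e.
tailE-half : ∀ b e → 1 ≤ b → b ≤ 2 → ⟦ tailE ⟧ (b + 2 * e ∷ []) ≡ e
tailE-half b e 1≤b b≤2 = trans (sumE-correct _ x₀ (b + 2 * e ∷ [])) (sumBelow-threshold-≤ _ e _ below above e≤m)
  where
  e≤m : e ≤ b + 2 * e
  e≤m = ≤-trans (m≤m+n e (e + 0)) (m≤n+m (2 * e) b)
  below : ∀ q → q < e → isZero (3 + 2 * q ∸ (b + 2 * e)) ≡ 1
  below q q<e = isZero-∸-≤ (+-mono-≤ 1≤b (≤-trans (≤-reflexive (sym (*-suc 2 q))) (*-monoʳ-≤ 2 q<e)))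
  above : ∀ q → e ≤ q → isZero (3 + 2 * q ∸ (b + 2 * e)) ≡ 0
  above q e≤q = isZero-∸-> (+-mono-≤ (s≤s b≤2) (*-monoʳ-≤ 2 e≤q))

tailE-correct : ∀ s → ⟦ tailE ⟧ (encS s ∷ []) ≡ encS (drop 1 s)
tailE-correct [] = refl
tailE-correct (false ∷ s) = tailE-half 1 (encS s) ≤-refl (s≤s z≤n)
tailE-correct (true ∷ s) = tailE-half 2 (encS s) (s≤s z≤n) ≤-refl

lengthE : Expr 1
lengthE = sumE (leqE (pow2 (lit 1 ⊕ x₀)) (lit 1 ⊕ x₁)) x₀

lengthE-correct : ∀ s → ⟦ lengthE ⟧ (encS s ∷ []) ≡ length s
lengthE-correct s =
  trans (sumE-correct _ x₀ (encS s ∷ [])) (sumBelow-threshold-≤ _ (length s) _ below above (length≤encS s))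
  where
  below : ∀ j → j < length s → isZero (2 ^ suc j ∸ suc (encS s)) ≡ 1
  below j j<L = isZero-∸-≤ (≤-trans (^-monoʳ-≤ 2 j<L) (2^length≤1+encS s))
  above : ∀ j → length s ≤ j → isZero (2 ^ suc j ∸ suc (encS s)) ≡ 0
  above j L≤j = isZero-∸-> (≤-trans (2+encS≤2^1+length s) (^-monoʳ-≤ 2 (s≤s L≤j)))

dropE : Expr 2
dropE = rec x₁ (call tailE (x₁ ∷ [])) x₀

drop-suc : ∀ {A : Set} k (xs : List A) → drop (suc k) xs ≡ drop 1 (drop k xs)
drop-suc zero xs = refl
drop-suc (suc k) [] = refl
drop-suc (suc k) (x ∷ xs) = drop-suc k xs

dropE-correct : ∀ k s → ⟦ dropE ⟧ (k ∷ encS s ∷ []) ≡ encS (drop k s)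
dropE-correct k s = go k
  where
  go : ∀ j → iterate x₁ (call tailE (x₁ ∷ [])) j (k ∷ encS s ∷ []) ≡ encS (drop j s)
  go zero = refl
  go (suc j) rewrite go j | drop-suc j s = tailE-correct (drop j s)

takeE : Expr 2
takeE = x₁ ⊝ pow2 x₀ ⊗ call dropE (x₀ ∷ x₁ ∷ [])

drop≡[]⊎length-take≡ : ∀ {A : Set} k (xs : List A) → drop k xs ≡ [] ⊎ length (take k xs) ≡ k
drop≡[]⊎length-take≡ zero xs = inj₂ refl
drop≡[]⊎length-take≡ (suc k) [] = inj₁ refl
drop≡[]⊎length-take≡ (suc k) (x ∷ xs) with drop≡[]⊎length-take≡ k xs
... | inj₁ eq = inj₁ eq
... | inj₂ eq = inj₂ (cong suc eq)

2^length-take-* : ∀ k s → 2 ^ length (take k s) * encS (drop k s) ≡ 2 ^ k * encS (drop k s)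
2^length-take-* k s with drop≡[]⊎length-take≡ k s
... | inj₁ eq rewrite eq = trans (*-zeroʳ (2 ^ length (take k s))) (sym (*-zeroʳ (2 ^ k)))
... | inj₂ eq rewrite eq = refl

takeE-correct : ∀ k s → ⟦ takeE ⟧ (k ∷ encS s ∷ []) ≡ encS (take k s)
takeE-correct k s rewrite dropE-correct k s = begin
  encS s ∸ 2 ^ k * encS (drop k s)
    ≡⟨ cong (λ t → encS t ∸ 2 ^ k * encS (drop k s)) (sym (take++drop≡id k s)) ⟩
  encS (take k s ++ drop k s) ∸ 2 ^ k * encS (drop k s)
    ≡⟨ cong (_∸ 2 ^ k * encS (drop k s)) (encS-++ (take k s) (drop k s)) ⟩
  encS (take k s) + 2 ^ length (take k s) * encS (drop k s) ∸ 2 ^ k * encS (drop k s)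
    ≡⟨ cong (λ w → encS (take k s) + w ∸ 2 ^ k * encS (drop k s)) (2^length-take-* k s) ⟩
  encS (take k s) + 2 ^ k * encS (drop k s) ∸ 2 ^ k * encS (drop k s)
    ≡⟨ m+n∸n≡m (encS (take k s)) (2 ^ k * encS (drop k s)) ⟩
  encS (take k s) ∎
  where open ≡-Reasoning

appendE : Expr 2
appendE = x₀ ⊕ pow2 (call lengthE (x₀ ∷ [])) ⊗ x₁

appendE-correct : ∀ s t → ⟦ appendE ⟧ (encS s ∷ encS t ∷ []) ≡ encS (s ++ t)
appendE-correct s t rewrite lengthE-correct s = sym (encS-++ s t)

⊑-refl : ∀ {s : Str} → s ⊑ s
⊑-refl {s} = [] , ++-identityʳ s

⊑-trans : ∀ {a b c : Str} → a ⊑ b → b ⊑ c → a ⊑ c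
⊑-trans {a} (r , refl) (r′ , refl) = r ++ r′ , sym (++-assoc a r r′)

take-++-≥ : ∀ {A : Set} (π r : List A) L → length π ≤ L → take L (π ++ r) ≡ π ++ take (L ∸ length π) r
take-++-≥ [] r L _ = refl
take-++-≥ (x ∷ π) r (suc L) (s≤s |π|≤L) = cong (x ∷_) (take-++-≥ π r L |π|≤L)

take-length-++ : ∀ {A : Set} (xs ys : List A) → take (length xs) (xs ++ ys) ≡ xs
take-length-++ [] ys = refl
take-length-++ (x ∷ xs) ys = cong (x ∷_) (take-length-++ xs ys)

drop-length-++ : ∀ {A : Set} (xs ys : List A) → drop (length xs) (xs ++ ys) ≡ ys
drop-length-++ [] ys = refl
drop-length-++ (x ∷ xs) ys = drop-length-++ xs ys

take-drop-++ : ∀ {A : Set} m n (xs ys : List A) → m + n ≤ length xs →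
               take n (drop m (xs ++ ys)) ≡ take n (drop m xs)
take-drop-++ zero zero xs ys _ = refl
take-drop-++ zero (suc n) (x ∷ xs) ys (s≤s le) = cong (x ∷_) (take-drop-++ zero n xs ys le)
take-drop-++ (suc m) n (x ∷ xs) ys (s≤s le) = take-drop-++ m n xs ys le

length-↾ : ∀ X n → length (X ↾ n) ≡ n
length-↾ X zero = refl
length-↾ X (suc n) = cong suc (length-↾ (λ k → X (suc k)) n)

take-↾ : ∀ X {a b} → a ≤ b → take a (X ↾ b) ≡ X ↾ a
take-↾ X {zero} a≤b = refl
take-↾ X {suc a} {suc b} (s≤s a≤b) = cong (X 0 ∷_) (take-↾ (λ k → X (suc k)) a≤b)

↾-++-drop : ∀ X {a b} → a ≤ b → X ↾ a ++ drop a (X ↾ b) ≡ X ↾ b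
↾-++-drop X {a} {b} a≤b =
  trans (cong (_++ drop a (X ↾ b)) (sym (take-↾ X a≤b))) (take++drop≡id a (X ↾ b))

extend : Str → Str → ℕ → Str
extend π out L = take L (π ++ (drop (length π) out ++ replicate L false))

length-extend : ∀ π out L → length (extend π out L) ≡ L
length-extend π out L = trans (length-take L _) (m≤n⇒m⊓n≡m L≤length)
  where
  L≤length : L ≤ length (π ++ (drop (length π) out ++ replicate L false))
  L≤length = subst (L ≤_) (sym (trans (length-++ π) (cong (length π +_)
                  (trans (length-++ (drop (length π) out)) (cong (_ +_) (length-replicate L))))))
               (≤-trans (m≤n+m L _) (m≤n+m _ (length π)))

extend-⊒ : ∀ π out L → length π ≤ L → π ⊑ extend π out L
extend-⊒ π out L |π|≤L = _ , sym (take-++-≥ π _ L |π|≤L)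

extend-↾ : ∀ X {a b} → a ≤ b → extend (X ↾ a) (X ↾ b) b ≡ X ↾ b
extend-↾ X {a} {b} a≤b = begin
  take b (X ↾ a ++ (drop (length (X ↾ a)) (X ↾ b) ++ replicate b false))
    ≡⟨ cong (λ n → take b (X ↾ a ++ (drop n (X ↾ b) ++ replicate b false))) (length-↾ X a) ⟩
  take b (X ↾ a ++ (drop a (X ↾ b) ++ replicate b false))
    ≡⟨ cong (take b) (sym (++-assoc (X ↾ a) _ _)) ⟩
  take b ((X ↾ a ++ drop a (X ↾ b)) ++ replicate b false)
    ≡⟨ cong (λ s → take b (s ++ replicate b false)) (↾-++-drop X a≤b) ⟩
  take b (X ↾ b ++ replicate b false)
    ≡⟨ cong (λ n → take n (X ↾ b ++ replicate b false)) (sym (length-↾ X b)) ⟩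
  take (length (X ↾ b)) (X ↾ b ++ replicate b false)
    ≡⟨ take-length-++ (X ↾ b) _ ⟩
  X ↾ b ∎
  where open ≡-Reasoning

-- Stage i reads the next block of the input, of length budget i + 1, as a padded
-- program for M with compression parameter c = ℓ i + 2, and extends the output
-- by M's output to length ℓ (i + 1) = max (c, f c).  The offset 2 makes the input
-- read by the first c stages exactly c bits shorter than their output.
module QuickProcess (f : ℕ → ℕ) (M : Str → Str) where

  mutual
    ℓ : ℕ → ℕ
    ℓ zero = 0
    ℓ (suc i) = param i + budget i

    param : ℕ → ℕ
    param i = ℓ i + 2

    budget : ℕ → ℕ
    budget i = f (param i) ∸ param i

  blockStart : ℕ → ℕ
  blockStart zero = 0
  blockStart (suc i) = blockStart i + suc (budget i)

  completeBlocks : ℕ → ℕ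
  completeBlocks zero = 0
  completeBlocks (suc n) = completeBlocks n + isZero (blockStart (suc (completeBlocks n)) ∸ suc n)

  program : ℕ → Str → Str
  program i τ = decS (encS (take (suc (budget i)) (drop (blockStart i) τ)) ∸ padding (budget i))

  output : ℕ → Str → Str
  output zero τ = []
  output (suc i) τ = extend (output i τ) (M (program i τ)) (ℓ (suc i))

  quick : Str → Str
  quick τ = output (completeBlocks (length τ)) τ

  order : ℕ → ℕ
  order n = ℓ (completeBlocks n)

  blockStart+i≡ℓ : ∀ i → blockStart i + i ≡ ℓ i
  blockStart+i≡ℓ zero = refl
  blockStart+i≡ℓ (suc i) =
    trans (shuffle (blockStart i) i (budget i)) (cong (λ z → z + 2 + budget i) (blockStart+i≡ℓ i))
    where
    shuffle : ∀ b i d → b + suc d + suc i ≡ b + i + 2 + d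
    shuffle = solve-∀

  ℓ<ℓ-suc : ∀ i → ℓ i < ℓ (suc i)
  ℓ<ℓ-suc i = ≤-trans (≤-trans (n≤1+n _) (≤-reflexive (+-comm 2 (ℓ i)))) (m≤m+n (param i) _)

  ℓ-mono : ∀ {i j} → i ≤ j → ℓ i ≤ ℓ j
  ℓ-mono = mono-ℕ-by-step ℓ (λ i → <⇒≤ (ℓ<ℓ-suc i))

  i≤ℓ : ∀ i → i ≤ ℓ i
  i≤ℓ zero = z≤n
  i≤ℓ (suc i) = ≤-trans (s≤s (i≤ℓ i)) (ℓ<ℓ-suc i)

  blockStart<blockStart-suc : ∀ i → blockStart i < blockStart (suc i)
  blockStart<blockStart-suc i = ≤-trans (≤-reflexive (+-comm 1 (blockStart i))) (+-monoʳ-≤ (blockStart i) (s≤s z≤n))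

  blockStart-mono : ∀ {i j} → i ≤ j → blockStart i ≤ blockStart j
  blockStart-mono = mono-ℕ-by-step blockStart (λ i → <⇒≤ (blockStart<blockStart-suc i))

  blockStart-mono-< : ∀ {i j} → i < j → blockStart i < blockStart j
  blockStart-mono-< {i} {suc j} (s≤s i≤j) = ≤-trans (s≤s (blockStart-mono i≤j)) (blockStart<blockStart-suc j)

  completeBlocks-spec : ∀ n → blockStart (completeBlocks n) ≤ n × n < blockStart (suc (completeBlocks n))
  completeBlocks-spec zero = z≤n , blockStart<blockStart-suc 0
  completeBlocks-spec (suc n) with completeBlocks-spec n | blockStart (suc (completeBlocks n)) ≤? suc n
  ... | lo , hi | yes next≤1+n rewrite isZero-∸-≤ next≤1+n | +-comm (completeBlocks n) 1 =
    next≤1+n ,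
    ≤-trans (s≤s (≤-reflexive (sym (≤-antisym next≤1+n hi)))) (blockStart<blockStart-suc (suc (completeBlocks n)))
  ... | lo , hi | no next≰1+n rewrite isZero-∸-> (≰⇒> next≰1+n) | +-identityʳ (completeBlocks n) =
    ≤-trans lo (n≤1+n n) , ≰⇒> next≰1+n

  completeBlocks-mono : ∀ {m n} → m ≤ n → completeBlocks m ≤ completeBlocks n
  completeBlocks-mono = mono-ℕ-by-step completeBlocks (λ n → m≤m+n (completeBlocks n) _)

  completeBlocks-blockStart : ∀ c → completeBlocks (blockStart c) ≡ c
  completeBlocks-blockStart c with completeBlocks-spec (blockStart c) | <-cmp (completeBlocks (blockStart c)) c
  ... | _ , hi | tri< k<c _ _ = ⊥-elim (<⇒≱ hi (blockStart-mono k<c))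
  ... | _ | tri≈ _ k≡c _ = k≡c
  ... | lo , _ | tri> _ _ c<k = ⊥-elim (<⇒≱ (blockStart-mono-< c<k) lo)

  length-output : ∀ i τ → length (output i τ) ≡ ℓ i
  length-output zero τ = refl
  length-output (suc i) τ = length-extend (output i τ) (M (program i τ)) (ℓ (suc i))

  output-mono : ∀ τ {i j} → i ≤ j → output i τ ⊑ output j τ
  output-mono τ = mono-by-step _⊑_ ⊑-refl ⊑-trans (λ i → output i τ) step
    where
    step : ∀ i → output i τ ⊑ output (suc i) τ
    step i = extend-⊒ (output i τ) _ (ℓ (suc i))
               (subst (_≤ ℓ (suc i)) (sym (length-output i τ)) (<⇒≤ (ℓ<ℓ-suc i)))

  output-++ : ∀ i τ ρ → blockStart i ≤ length τ → output i τ ≡ output i (τ ++ ρ)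
  output-++ zero τ ρ _ = refl
  output-++ (suc i) τ ρ next≤|τ|
    rewrite output-++ i τ ρ (≤-trans (<⇒≤ (blockStart<blockStart-suc i)) next≤|τ|)
          | take-drop-++ (blockStart i) (suc (budget i)) τ ρ next≤|τ| = refl

  quick-mono : ∀ τ τ′ → τ ⊑ τ′ → quick τ ⊑ quick τ′
  quick-mono τ _ (ρ , refl) =
    subst (_⊑ quick (τ ++ ρ)) (sym (output-++ k τ ρ (proj₁ (completeBlocks-spec (length τ)))))
      (output-mono (τ ++ ρ) (completeBlocks-mono (subst (length τ ≤_) (sym (length-++ τ)) (m≤m+n _ _))))
    where k = completeBlocks (length τ)

  order-length-quick : ∀ τ → order (length τ) ≤ length (quick τ)
  order-length-quick τ = ≤-reflexive (sym (length-output (completeBlocks (length τ)) τ))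

  order-isOrder : IsOrder order
  order-isOrder = (λ m n m≤n → ℓ-mono (completeBlocks-mono m≤n))
                , (λ k → blockStart k , subst (λ j → k ≤ ℓ j) (sym (completeBlocks-blockStart k)) (i≤ℓ k))

  -- quick compresses X at ℓ c with the concatenation of the padded M-programs σ (param i), i < c
  module Compressed (X : Real) (σ : ℕ → Str) (M-σ : ∀ c → M (σ c) ≡ X ↾ f c)
                    (length-σ : ∀ c → length (σ c) + c ≤ f c) where

    ℓ-suc≡f-param : ∀ i → ℓ (suc i) ≡ f (param i)
    ℓ-suc≡f-param i = m+[n∸m]≡n (≤-trans (m≤n+m (param i) (length (σ (param i)))) (length-σ (param i)))

    length-σ≤budget : ∀ i → length (σ (param i)) ≤ budget i
    length-σ≤budget i = ≤-trans (≤-reflexive (sym (m+n∸n≡m (length (σ (param i))) (param i))))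
                                (∸-monoˡ-≤ (param i) (length-σ (param i)))

    padded : ℕ → Str
    padded i = decS (encS (σ (param i)) + padding (budget i))

    length-padded : ∀ i → length (padded i) ≡ suc (budget i)
    length-padded i = length-pad (σ (param i)) (budget i) (length-σ≤budget i)

    input : ℕ → Str
    input zero = []
    input (suc c) = input c ++ padded c

    length-input : ∀ c → length (input c) ≡ blockStart c
    length-input zero = refl
    length-input (suc c) = trans (length-++ (input c)) (cong₂ _+_ (length-input c) (length-padded c))

    input-split : ∀ {i c} → i < c → ∃ λ rest → input c ≡ input i ++ (padded i ++ rest)
    input-split {i} {suc c} (s≤s i≤c) with m≤n⇒m<n∨m≡n i≤c
    ... | inj₂ refl = [] , cong (input i ++_) (sym (++-identityʳ (padded i)))
    ... | inj₁ i<c with input-split i<c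
    ...   | rest , eq = rest ++ padded c ,
            trans (cong (_++ padded c) eq)
              (trans (++-assoc (input i) (padded i ++ rest) (padded c))
                     (cong (input i ++_) (++-assoc (padded i) rest (padded c))))

    program-input : ∀ {i c} → i < c → program i (input c) ≡ σ (param i)
    program-input {i} {c} i<c with input-split i<c
    ... | rest , eq rewrite eq | sym (length-input i) | drop-length-++ (input i) (padded i ++ rest) = begin
      decS (encS (take (suc (budget i)) (padded i ++ rest)) ∸ padding (budget i))
        ≡⟨ cong (λ n → decS (encS (take n (padded i ++ rest)) ∸ padding (budget i))) (sym (length-padded i)) ⟩
      decS (encS (take (length (padded i)) (padded i ++ rest)) ∸ padding (budget i))
        ≡⟨ cong (λ s → decS (encS s ∸ padding (budget i))) (take-length-++ (padded i) rest) ⟩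
      decS (encS (padded i) ∸ padding (budget i))
        ≡⟨ cong (λ m → decS (m ∸ padding (budget i))) (encS-decS _) ⟩
      decS (encS (σ (param i)) + padding (budget i) ∸ padding (budget i))
        ≡⟨ cong decS (m+n∸n≡m (encS (σ (param i))) (padding (budget i))) ⟩
      decS (encS (σ (param i)))
        ≡⟨ decS-encS (σ (param i)) ⟩
      σ (param i) ∎
      where open ≡-Reasoning

    output-input : ∀ {i c} → i ≤ c → output i (input c) ≡ X ↾ ℓ i
    output-input {zero} _ = refl
    output-input {suc i} {c} i<c = begin
      extend (output i (input c)) (M (program i (input c))) (ℓ (suc i))
        ≡⟨ cong₂ (λ π out → extend π out (ℓ (suc i))) (output-input (<⇒≤ i<c))
                 (trans (cong M (program-input i<c)) (M-σ (param i))) ⟩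
      extend (X ↾ ℓ i) (X ↾ f (param i)) (ℓ (suc i))
        ≡⟨ cong (λ n → extend (X ↾ ℓ i) (X ↾ n) (ℓ (suc i))) (sym (ℓ-suc≡f-param i)) ⟩
      extend (X ↾ ℓ i) (X ↾ ℓ (suc i)) (ℓ (suc i))
        ≡⟨ extend-↾ X (<⇒≤ (ℓ<ℓ-suc i)) ⟩
      X ↾ ℓ (suc i) ∎
      where open ≡-Reasoning

    quick-input : ∀ c → ∃ λ τ → (quick τ ≡ X ↾ ℓ c) × (length τ + c ≤ ℓ c)
    quick-input c = input c
      , trans (cong (λ n → output (completeBlocks n) (input c)) (length-input c))
          (trans (cong (λ k → output k (input c)) (completeBlocks-blockStart c)) (output-input {c} ≤-refl))
      , ≤-reflexive (trans (cong (_+ c) (length-input c)) (blockStart+i≡ℓ c))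

extendE : Expr 3
extendE = call takeE (x₂ ∷ call appendE (x₀ ∷ call appendE (tail ∷ pow2 x₂ ⊝ lit 1 ∷ []) ∷ []) ∷ [])
  where
  tail : Expr 3
  tail = call dropE (call lengthE (x₀ ∷ []) ∷ x₁ ∷ [])

extendE-correct : ∀ π out L → ⟦ extendE ⟧ (encS π ∷ encS out ∷ L ∷ []) ≡ encS (extend π out L)
extendE-correct π out L
  rewrite lengthE-correct π | dropE-correct (length π) out | sym (encS-replicate-false L)
        | appendE-correct (drop (length π) out) (replicate L false)
        | sym (encS-++ π (drop (length π) out ++ replicate L false)) =
  takeE-correct L (π ++ (drop (length π) out ++ replicate L false))

module QuickProcessPR (f : ℕ → ℕ) (M : Str → Str) (f-PR : IsPR f) (M-PR : IsPRStr M) where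
  open QuickProcess f M
  pf = proj₁ f-PR
  pM = proj₁ M-PR

  ℓE : Expr 1
  ℓE = rec (lit 0) ((x₁ ⊕ lit 2) ⊕ (apply pf (x₁ ⊕ lit 2) ⊝ (x₁ ⊕ lit 2))) x₀

  ℓE-correct : ∀ i → ⟦ ℓE ⟧ (i ∷ []) ≡ ℓ i
  ℓE-correct i = go i
    where
    go : ∀ j → iterate (lit 0) ((x₁ ⊕ lit 2) ⊕ (apply pf (x₁ ⊕ lit 2) ⊝ (x₁ ⊕ lit 2))) j (i ∷ []) ≡ ℓ j
    go zero = refl
    go (suc j) rewrite go j | proj₂ f-PR (ℓ j + 2) = refl

  budgetE : Expr 1
  budgetE = apply pf (call ℓE (x₀ ∷ []) ⊕ lit 2) ⊝ (call ℓE (x₀ ∷ []) ⊕ lit 2)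

  budgetE-correct : ∀ i → ⟦ budgetE ⟧ (i ∷ []) ≡ budget i
  budgetE-correct i rewrite ℓE-correct i | proj₂ f-PR (ℓ i + 2) = refl

  blockStartE : Expr 1
  blockStartE = rec (lit 0) (x₁ ⊕ (lit 1 ⊕ call budgetE (x₀ ∷ []))) x₀

  blockStartE-correct : ∀ i → ⟦ blockStartE ⟧ (i ∷ []) ≡ blockStart i
  blockStartE-correct i = go i
    where
    go : ∀ j → iterate (lit 0) (x₁ ⊕ (lit 1 ⊕ call budgetE (x₀ ∷ []))) j (i ∷ []) ≡ blockStart j
    go zero = refl
    go (suc j) rewrite go j | budgetE-correct j = refl

  completeBlocksE : Expr 1
  completeBlocksE = rec (lit 0) step x₀
    where
    step : Expr 3
    step = x₁ ⊕ is0 (call blockStartE (lit 1 ⊕ x₁ ∷ []) ⊝ (lit 1 ⊕ x₀))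

  completeBlocksE-correct : ∀ n → ⟦ completeBlocksE ⟧ (n ∷ []) ≡ completeBlocks n
  completeBlocksE-correct n = go n
    where
    go : ∀ j → ⟦ rec (lit 0) (x₁ ⊕ is0 (call blockStartE (lit 1 ⊕ x₁ ∷ []) ⊝ (lit 1 ⊕ x₀))) (lit j) ⟧ (n ∷ [])
               ≡ completeBlocks j
    go zero = refl
    go (suc j) rewrite go j | blockStartE-correct (suc (completeBlocks j)) = refl

  orderE : Expr 1
  orderE = call ℓE (call completeBlocksE (x₀ ∷ []) ∷ [])

  orderE-correct : ∀ n → ⟦ orderE ⟧ (n ∷ []) ≡ order n
  orderE-correct n rewrite completeBlocksE-correct n = ℓE-correct (completeBlocks n)

  programE : Expr 2
  programE = call takeE (lit 1 ⊕ budget′ ∷ call dropE (call blockStartE (x₀ ∷ []) ∷ x₁ ∷ []) ∷ [])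
             ⊝ (pow2 (lit 1 ⊕ budget′) ⊝ lit 1)
    where
    budget′ : Expr 2
    budget′ = call budgetE (x₀ ∷ [])

  programE-correct : ∀ i τ → ⟦ programE ⟧ (i ∷ encS τ ∷ []) ≡ encS (program i τ)
  programE-correct i τ
    rewrite budgetE-correct i | blockStartE-correct i | dropE-correct (blockStart i) τ
          | takeE-correct (suc (budget i)) (drop (blockStart i) τ) = sym (encS-decS _)

  outputStep : Expr 4
  outputStep = call extendE (x₁ ∷ apply pM (call programE (x₀ ∷ x₃ ∷ [])) ∷ call ℓE (lit 1 ⊕ x₀ ∷ []) ∷ [])

  outputE : Expr 2
  outputE = rec (lit 0) outputStep x₀

  outputE-correct : ∀ i τ → ⟦ outputE ⟧ (i ∷ encS τ ∷ []) ≡ encS (output i τ)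
  outputE-correct i τ = go i
    where
    extendE-cong : ∀ {a b c π out L} → a ≡ encS π → b ≡ encS out → c ≡ L →
                   ⟦ extendE ⟧ (a ∷ b ∷ c ∷ []) ≡ encS (extend π out L)
    extendE-cong {π = π} {out} {L} refl refl refl = extendE-correct π out L
    go : ∀ j → iterate (lit 0) outputStep j (i ∷ encS τ ∷ []) ≡ encS (output j τ)
    go zero = refl
    go (suc j) = extendE-cong {π = output j τ} {M (program j τ)} (go j)
      (trans (cong (λ m → evalPR pM (m ∷ [])) (programE-correct j τ)) (proj₂ M-PR (program j τ)))
      (ℓE-correct (suc j))

  quickE : Expr 1
  quickE = call outputE (call completeBlocksE (call lengthE (x₀ ∷ []) ∷ []) ∷ x₀ ∷ [])

  quickE-correct : ∀ τ → ⟦ quickE ⟧ (encS τ ∷ []) ≡ encS (quick τ)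
  quickE-correct τ rewrite lengthE-correct τ | completeBlocksE-correct (length τ) =
    outputE-correct (completeBlocks (length τ)) τ

  quick-isQuickProcess : IsQuickProcessBP quick
  quick-isQuickProcess = Expr⇒IsPRStr quickE {quick} quickE-correct
                       , quick-mono
                       , order , Expr⇒IsPR orderE orderE-correct , order-isOrder , order-length-quick

  ℓ-PR : IsPR ℓ
  ℓ-PR = Expr⇒IsPR ℓE ℓE-correct

bool→ℕ : Bool → ℕ
bool→ℕ true = 1
bool→ℕ false = 0

count : {A : Set} → (A → Bool) → List A → ℕ
count p xs = sum (map (λ x → bool→ℕ (p x)) xs)

length-filterᵇ : {A : Set} (p : A → Bool) (xs : List A) → length (filterᵇ p xs) ≡ count p xs
length-filterᵇ p [] = refl
length-filterᵇ p (x ∷ xs) with p x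
... | true = cong suc (length-filterᵇ p xs)
... | false = length-filterᵇ p xs

count-++ : {A : Set} (p : A → Bool) (xs ys : List A) → count p (xs ++ ys) ≡ count p xs + count p ys
count-++ p [] ys = refl
count-++ p (x ∷ xs) ys rewrite count-++ p xs ys = sym (+-assoc (bool→ℕ (p x)) _ _)

count-map : {A B : Set} (p : B → Bool) (g : A → B) (xs : List A) → count p (map g xs) ≡ count (λ x → p (g x)) xs
count-map p g [] = refl
count-map p g (x ∷ xs) = cong (bool→ℕ (p (g x)) +_) (count-map p g xs)

count-false : {A : Set} (p : A → Bool) (xs : List A) → (∀ x → p x ≡ false) → count p xs ≡ 0
count-false p [] _ = refl
count-false p (x ∷ xs) p≗false rewrite p≗false x = count-false p xs p≗false

count-∨ : {A : Set} (p q : A → Bool) (xs : List A) → count (λ x → p x ∨ q x) xs ≤ count p xs + count q xs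
count-∨ p q [] = z≤n
count-∨ p q (x ∷ xs) =
  ≤-trans (+-mono-≤ (bool→ℕ-∨ (p x) (q x)) (count-∨ p q xs))
          (≤-reflexive (interchange (bool→ℕ (p x)) (bool→ℕ (q x)) (count p xs) (count q xs)))
  where
  bool→ℕ-∨ : ∀ a b → bool→ℕ (a ∨ b) ≤ bool→ℕ a + bool→ℕ b
  bool→ℕ-∨ true b = s≤s z≤n
  bool→ℕ-∨ false b = ≤-refl
  interchange : ∀ a b c d → a + b + (c + d) ≡ a + c + (b + d)
  interchange = solve-∀

coveredBy : List Str → Str → Bool
coveredBy G τ = any (λ σ → isPrefix σ τ) G

count-coveredBy : ∀ G xs → count (coveredBy G) xs ≤ sum (map (λ σ → count (isPrefix σ) xs) G)
count-coveredBy [] xs = ≤-reflexive (count-false _ xs (λ _ → refl))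
count-coveredBy (σ ∷ G) xs =
  ≤-trans (count-∨ (isPrefix σ) (coveredBy G) xs) (+-monoʳ-≤ (count (isPrefix σ) xs) (count-coveredBy G xs))

count-allStrings-suc : ∀ L (q : Str → Bool) →
  count q (allStrings (suc L))
  ≡ count (λ τ → q (false ∷ τ)) (allStrings L) + count (λ τ → q (true ∷ τ)) (allStrings L)
count-allStrings-suc L q
  rewrite count-++ q (map (false ∷_) (allStrings L)) (map (true ∷_) (allStrings L))
        | count-map q (false ∷_) (allStrings L) | count-map q (true ∷_) (allStrings L) = refl

count-isPrefix-allStrings : ∀ σ → count (isPrefix σ) (allStrings (length σ)) ≡ 1
count-isPrefix-allStrings [] = refl
count-isPrefix-allStrings (false ∷ σ)
  rewrite count-allStrings-suc (length σ) (isPrefix (false ∷ σ)) | count-isPrefix-allStrings σ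
        | count-false (λ τ → isPrefix (false ∷ σ) (true ∷ τ)) (allStrings (length σ)) (λ _ → refl) = refl
count-isPrefix-allStrings (true ∷ σ)
  rewrite count-allStrings-suc (length σ) (isPrefix (true ∷ σ)) | count-isPrefix-allStrings σ
        | count-false (λ τ → isPrefix (true ∷ σ) (false ∷ τ)) (allStrings (length σ)) (λ _ → refl) = refl

maxLen-uniform : ∀ L (G : List Str) → All (λ σ → length σ ≡ L) G → G ≢ [] → maxLen G ≡ L
maxLen-uniform L [] _ G≢[] = ⊥-elim (G≢[] refl)
maxLen-uniform L (σ ∷ []) (refl ∷ []) _ = ⊔-identityʳ L
maxLen-uniform L (σ ∷ τ ∷ G) (refl ∷ lengths) _
  rewrite maxLen-uniform L (τ ∷ G) lengths (λ ()) = ⊔-idem L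

-- each string of a uniform set covers exactly one string of its length
countCovered-uniform : ∀ L (G : List Str) → All (λ σ → length σ ≡ L) G → countCovered G ≤ length G
countCovered-uniform L [] _ = z≤n
countCovered-uniform L G@(_ ∷ _) lengths
  rewrite maxLen-uniform L G lengths (λ ()) | length-filterᵇ (coveredBy G) (allStrings L) =
  ≤-trans (count-coveredBy G (allStrings L)) (≤-reflexive (ones G lengths))
  where
  ones : ∀ G → All (λ σ → length σ ≡ L) G →
         sum (map (λ σ → count (isPrefix σ) (allStrings L)) G) ≡ length G
  ones [] _ = refl
  ones (σ ∷ G) (refl ∷ lengths) rewrite count-isPrefix-allStrings σ = cong suc (ones G lengths)

measure-uniform : ∀ L n (G : List Str) → All (λ σ → length σ ≡ L) G →
                  length G * 2 ^ n ≤ 2 ^ L → μ[ G ]≤2^- n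
measure-uniform L n [] _ _ = z≤n
measure-uniform L n G@(_ ∷ _) lengths bound =
  ≤-trans (*-monoˡ-≤ (2 ^ n) (countCovered-uniform L G lengths))
          (subst (λ m → length G * 2 ^ n ≤ 2 ^ m) (sym (maxLen-uniform L G lengths (λ ()))) bound)

consIf : ℕ → Str → List Str → List Str
consIf zero x l = l
consIf (suc _) x l = x ∷ l

consIfE : Expr 3
consIfE = is0 (is0 x₀) ⊗ (pow2 x₁ ⊗ (lit 1 ⊕ lit 2 ⊗ x₂)) ⊕ is0 x₀ ⊗ x₂

consIfE-correct : ∀ g x l → ⟦ consIfE ⟧ (g ∷ encS x ∷ encSet l ∷ []) ≡ encSet (consIf g x l)
consIfE-correct zero x l = +-identityʳ (encSet l)
consIfE-correct (suc g) x l = trans (+-identityʳ _) (+-identityʳ _)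

consIf-∈ : ∀ {P : Str → Set} g x l → Any P l → Any P (consIf g x l)
consIf-∈ zero x l p = p
consIf-∈ (suc g) x l p = there p

-- The c-th test collects the M-outputs of length L = f (c + 1) of all programs of
-- length ≤ L − (c + 1), i.e. of codes below padding (L − (c + 1)).
module CompressionTest (f : ℕ → ℕ) (M : Str → Str) where

  L : ℕ → ℕ
  L c = f (suc c)

  good : ℕ → ℕ → ℕ
  good c s = isZero (suc c ∸ L c) * eqIndicator (length (M (decS s))) (L c)

  good-≢0 : ∀ c s → good c s ≢ 0 → suc c ≤ L c × length (M (decS s)) ≡ L c
  good-≢0 c s ≢0 with isZero-*-≢0 (suc c ∸ L c) _ ≢0
  ... | c<L , ≡L = m∸n≡0⇒m≤n c<L , eqIndicator-≢0 _ _ ≡L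

  good-one : ∀ c s → suc c ≤ L c → length (M (decS s)) ≡ L c → good c s ≡ 1
  good-one c s c<L ≡L rewrite m≤n⇒m∸n≡0 c<L | ≡L = trans (+-identityʳ _) (eqIndicator-refl (L c))

  enumerate : ℕ → ℕ → List Str
  enumerate c zero = []
  enumerate c (suc s) = consIf (good c s) (M (decS s)) (enumerate c s)

  candidates : ℕ → ℕ
  candidates c = padding (L c ∸ suc c)

  test : ℕ → List Str
  test c = enumerate c (candidates c)

  enumerate-uniform : ∀ c s → All (λ σ → length σ ≡ L c) (enumerate c s)
  enumerate-uniform c zero = []
  enumerate-uniform c (suc s) with good c s in eq
  ... | zero = enumerate-uniform c s
  ... | suc _ = proj₂ (good-≢0 c s (λ ≡0 → 0≢1+n (trans (sym ≡0) eq))) ∷ enumerate-uniform c s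

  length-enumerate : ∀ c s → length (enumerate c s) ≤ s
  length-enumerate c zero = z≤n
  length-enumerate c (suc s) with good c s
  ... | zero = m≤n⇒m≤1+n (length-enumerate c s)
  ... | suc _ = s≤s (length-enumerate c s)

  enumerate-≡[] : ∀ c s → ¬ (suc c ≤ L c) → enumerate c s ≡ []
  enumerate-≡[] c zero _ = refl
  enumerate-≡[] c (suc s) c≮L with good c s in eq
  ... | zero = enumerate-≡[] c s c≮L
  ... | suc _ = ⊥-elim (c≮L (proj₁ (good-≢0 c s (λ ≡0 → 0≢1+n (trans (sym ≡0) eq)))))

  enumerate-∈ : ∀ {P : Str → Set} c {s n} → s < n → good c s ≡ 1 → P (M (decS s)) → Any P (enumerate c n)
  enumerate-∈ c {s} {suc n} (s≤s s≤n) good≡1 p with m≤n⇒m<n∨m≡n s≤n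
  ... | inj₁ s<n = consIf-∈ (good c n) _ _ (enumerate-∈ c s<n good≡1 p)
  ... | inj₂ refl rewrite good≡1 = here p

  test-measure : ∀ c → μ[ test c ]≤2^- c
  test-measure c with suc c ≤? L c
  ... | no c≮L rewrite enumerate-≡[] c (candidates c) c≮L = z≤n
  ... | yes c<L = measure-uniform (L c) c (test c) (enumerate-uniform c (candidates c)) (begin
    length (test c) * 2 ^ c                ≤⟨ *-monoˡ-≤ (2 ^ c) (length-enumerate c (candidates c)) ⟩
    candidates c * 2 ^ c                   ≤⟨ *-monoˡ-≤ (2 ^ c) (m∸n≤m (2 ^ suc (L c ∸ suc c)) 1) ⟩
    2 ^ suc (L c ∸ suc c) * 2 ^ c          ≡⟨ sym (^-distribˡ-+-* 2 (suc (L c ∸ suc c)) c) ⟩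
    2 ^ (suc (L c ∸ suc c) + c)            ≡⟨ cong (2 ^_) exponent ⟩
    2 ^ L c                                ∎)
    where
    open ≤-Reasoning
    exponent : suc (L c ∸ suc c) + c ≡ L c
    exponent = trans (+-comm (suc (L c ∸ suc c)) c) (trans (+-suc c _) (m+[n∸m]≡n c<L))

  module _ (X : Real) (compress : ∀ c → ∃ λ σ → (M σ ≡ X ↾ f c) × (length σ + c ≤ f c)) where

    test-∋ : ∀ c → X ∈[ test c ]
    test-∋ c = enumerate-∈ c (encS<padding σ _ |σ|≤d) (good-one c (encS σ) c<L |Mσ|≡L) X↾|Mσ|
      where
      σ = proj₁ (compress (suc c))
      M-σ = proj₁ (proj₂ (compress (suc c)))
      length-σ = proj₂ (proj₂ (compress (suc c)))
      c<L : suc c ≤ L c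
      c<L = ≤-trans (m≤n+m (suc c) _) length-σ
      |σ|≤d : length σ ≤ L c ∸ suc c
      |σ|≤d = ≤-trans (≤-reflexive (sym (m+n∸n≡m _ (suc c)))) (∸-monoˡ-≤ (suc c) length-σ)
      M-decS : M (decS (encS σ)) ≡ X ↾ L c
      M-decS = trans (cong M (decS-encS σ)) M-σ
      |Mσ|≡L : length (M (decS (encS σ))) ≡ L c
      |Mσ|≡L = trans (cong length M-decS) (length-↾ X (L c))
      X↾|Mσ| : X ↾ length (M (decS (encS σ))) ≡ M (decS (encS σ))
      X↾|Mσ| = trans (cong (X ↾_) |Mσ|≡L) (sym M-decS)

module CompressionTestPR (f : ℕ → ℕ) (M : Str → Str) (f-PR : IsPR f) (M-PR : IsPRStr M) where
  open CompressionTest f M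
  pf = proj₁ f-PR
  pM = proj₁ M-PR

  evalPR-M-decS : ∀ s → evalPR pM (s ∷ []) ≡ encS (M (decS s))
  evalPR-M-decS s = trans (cong (λ m → evalPR pM (m ∷ [])) (sym (encS-decS s))) (proj₂ M-PR (decS s))

  LE : Expr 2
  LE = apply pf (lit 1 ⊕ x₁)

  goodE : Expr 2
  goodE = is0 ((lit 1 ⊕ x₁) ⊝ LE) ⊗ eqE (call lengthE (apply pM x₀ ∷ [])) LE

  goodE-correct : ∀ s c → ⟦ goodE ⟧ (s ∷ c ∷ []) ≡ good c s
  goodE-correct s c rewrite proj₂ f-PR (suc c) | evalPR-M-decS s | lengthE-correct (M (decS s)) = refl

  enumerateStep : Expr 3
  enumerateStep = call consIfE (call goodE (x₀ ∷ x₂ ∷ []) ∷ apply pM x₀ ∷ x₁ ∷ [])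

  testE : Expr 1
  testE = rec (lit 0) enumerateStep (pow2 (lit 1 ⊕ (apply pf (lit 1 ⊕ x₀) ⊝ (lit 1 ⊕ x₀))) ⊝ lit 1)

  testE-correct : ∀ c → ⟦ testE ⟧ (c ∷ []) ≡ encSet (test c)
  testE-correct c rewrite proj₂ f-PR (suc c) = go (candidates c)
    where
    go : ∀ s → iterate (lit 0) enumerateStep s (c ∷ []) ≡ encSet (enumerate c s)
    go zero = refl
    go (suc s) rewrite go s | goodE-correct s c | evalPR-M-decS s =
      consIfE-correct (good c s) (M (decS s)) (enumerate c s)

  test-isPRTest : IsPRTest test
  test-isPRTest =
    (compile testE , λ c → trans (compile-correct testE (c ∷ [])) (testE-correct c)) , test-measure

pair : ℕ → ℕ → ℕ
pair x y = 2 ^ x * (1 + 2 * y)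

pair-pos : ∀ x y → 1 ≤ pair x y
pair-pos x y = ≤-trans (m^n>0 2 x) (m≤m*n (2 ^ x) (1 + 2 * y))

x≤pair : ∀ x y → x ≤ pair x y
x≤pair x y = ≤-trans (<⇒≤ (n<2^n x)) (m≤m*n (2 ^ x) (1 + 2 * y))

y≤pair : ∀ x y → y ≤ pair x y
y≤pair x y = ≤-trans (≤-trans (m≤m+n y (y + 0)) (n≤1+n _)) (m≤n*m (1 + 2 * y) (2 ^ x) {{2^-nonZero x}})

pair-divisible : ∀ j x y → j < x → ∃ λ q → q * 2 ^ suc j ≡ pair x y
pair-divisible j x y j<x with m≤n⇒∃[o]m+o≡n j<x
... | t , refl = 2 ^ t * (1 + 2 * y) , (begin
  2 ^ t * (1 + 2 * y) * 2 ^ suc j     ≡⟨ regroup (2 ^ t) (1 + 2 * y) (2 ^ suc j) ⟩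
  2 ^ suc j * 2 ^ t * (1 + 2 * y)     ≡⟨ cong (_* (1 + 2 * y)) (sym (^-distribˡ-+-* 2 (suc j) t)) ⟩
  2 ^ (suc j + t) * (1 + 2 * y)       ∎)
  where
  open ≡-Reasoning
  regroup : ∀ a b c → a * b * c ≡ c * a * b
  regroup = solve-∀

pair-not-divisible : ∀ j x y → x ≤ j → ∀ q → q * 2 ^ suc j ≢ pair x y
pair-not-divisible j x y x≤j q with m≤n⇒∃[o]m+o≡n x≤j
... | t , refl = λ eq → even≢odd (q * 2 ^ t) y (*-cancelˡ-≡ _ _ (2 ^ x) {{2^-nonZero x}} (trans regroup eq))
  where
  open ≡-Reasoning
  shuffle : ∀ a b c → c * (2 * (a * b)) ≡ a * (2 * (c * b))
  shuffle = solve-∀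
  regroup : 2 ^ x * (2 * (q * 2 ^ t)) ≡ q * 2 ^ suc (x + t)
  regroup = begin
    2 ^ x * (2 * (q * 2 ^ t))   ≡⟨ shuffle q (2 ^ t) (2 ^ x) ⟩
    q * (2 * (2 ^ x * 2 ^ t))   ≡⟨ cong (λ p → q * (2 * p)) (sym (^-distribˡ-+-* 2 x t)) ⟩
    q * 2 ^ suc (x + t)         ∎

-- 2^(j+1) divides m iff some q ≤ m has q · 2^(j+1) = m
pow2DividesE : Expr 2
pow2DividesE = is0 (is0 (sumE (eqE (x₀ ⊗ pow2 (lit 1 ⊕ x₁)) x₂) (lit 1 ⊕ x₁)))

pow2DividesE-yes : ∀ j m q → q * 2 ^ suc j ≡ m → ⟦ pow2DividesE ⟧ (j ∷ m ∷ []) ≡ 1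
pow2DividesE-yes j m q eq =
  trans (cong isPositive (sumE-correct _ (lit 1 ⊕ x₁) (j ∷ m ∷ [])))
        (isPositive-pos _ (sumBelow-pos _ (suc m) q q≤m (≤-reflexive (sym hit))))
  where
  q≤m : q < suc m
  q≤m = s≤s (subst (q ≤_) eq (m≤m*n q (2 ^ suc j) {{2^-nonZero (suc j)}}))
  hit : eqIndicator (q * 2 ^ suc j) m ≡ 1
  hit = subst (λ n → eqIndicator (q * 2 ^ suc j) n ≡ 1) eq (eqIndicator-refl (q * 2 ^ suc j))

pow2DividesE-no : ∀ j m → (∀ q → q * 2 ^ suc j ≢ m) → ⟦ pow2DividesE ⟧ (j ∷ m ∷ []) ≡ 0
pow2DividesE-no j m never =
  trans (cong isPositive (sumE-correct _ (lit 1 ⊕ x₁) (j ∷ m ∷ [])))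
        (cong isPositive (sumBelow-zero _ (suc m) (λ q _ → eqIndicator-≢ _ _ (never q))))

-- the 2-adic valuation, i.e. the head of a list code
headCodeE : Expr 1
headCodeE = sumE (call pow2DividesE (x₀ ∷ x₁ ∷ [])) x₀

headCodeE-correct : ∀ x y → ⟦ headCodeE ⟧ (pair x y ∷ []) ≡ x
headCodeE-correct x y =
  trans (sumE-correct _ x₀ (pair x y ∷ [])) (sumBelow-threshold-≤ _ x (pair x y) below above (x≤pair x y))
  where
  below : ∀ j → j < x → ⟦ pow2DividesE ⟧ (j ∷ pair x y ∷ []) ≡ 1
  below j j<x = let (q , eq) = pair-divisible j x y j<x in pow2DividesE-yes j _ q eq
  above : ∀ j → x ≤ j → ⟦ pow2DividesE ⟧ (j ∷ pair x y ∷ []) ≡ 0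
  above j x≤j = pow2DividesE-no j _ (pair-not-divisible j x y x≤j)

tailCodeE : Expr 1
tailCodeE = sumE (leqE (pow2 (call headCodeE (x₁ ∷ [])) ⊗ (lit 3 ⊕ lit 2 ⊗ x₀)) x₁) x₀

tailCodeE-correct : ∀ x y → ⟦ tailCodeE ⟧ (pair x y ∷ []) ≡ y
tailCodeE-correct x y =
  trans (sumE-correct _ x₀ (pair x y ∷ [])) (sumBelow-threshold-≤ _ y (pair x y) below above (y≤pair x y))
  where
  below : ∀ q → q < y → isZero (2 ^ ⟦ headCodeE ⟧ (pair x y ∷ []) * (3 + 2 * q) ∸ pair x y) ≡ 1
  below q q<y rewrite headCodeE-correct x y =
    isZero-∸-≤ (*-monoʳ-≤ (2 ^ x) (s≤s (≤-trans (≤-reflexive (sym (*-suc 2 q))) (*-monoʳ-≤ 2 q<y))))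
  above : ∀ q → y ≤ q → isZero (2 ^ ⟦ headCodeE ⟧ (pair x y ∷ []) * (3 + 2 * q) ∸ pair x y) ≡ 0
  above q y≤q rewrite headCodeE-correct x y =
    isZero-∸-> (*-monoʳ-< (2 ^ x) {{2^-nonZero x}} (s≤s (s≤s (≤-trans (*-monoʳ-≤ 2 y≤q) (n≤1+n _)))))

tailCodeE-encL : ∀ l → ⟦ tailCodeE ⟧ (encL l ∷ []) ≡ encL (drop 1 l)
tailCodeE-encL [] = refl
tailCodeE-encL (x ∷ l) = tailCodeE-correct x (encL l)

dropCodeE : Expr 2
dropCodeE = rec x₁ (call tailCodeE (x₁ ∷ [])) x₀

dropCodeE-correct : ∀ k l → ⟦ dropCodeE ⟧ (k ∷ encL l ∷ []) ≡ encL (drop k l)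
dropCodeE-correct k l = go k
  where
  go : ∀ j → iterate x₁ (call tailCodeE (x₁ ∷ [])) j (k ∷ encL l ∷ []) ≡ encL (drop j l)
  go zero = refl
  go (suc j) rewrite go j | drop-suc j l = tailCodeE-encL (drop j l)

length≤encL : ∀ l → length l ≤ encL l
length≤encL [] = z≤n
length≤encL (x ∷ l) =
  ≤-trans (s≤s (length≤encL l)) (≤-trans (s≤s (m≤m+n _ _)) (m≤n*m (1 + 2 * encL l) (2 ^ x) {{2^-nonZero x}}))

headOr0 : (Str → ℕ) → List Str → ℕ
headOr0 v [] = 0
headOr0 v (σ ∷ _) = v σ

nthOr0 : (Str → ℕ) → List Str → ℕ → ℕ
nthOr0 v G k = headOr0 v (drop k G)

sumBelow-nthOr0 : ∀ v G n → length G ≤ n → sumBelow (nthOr0 v G) n ≡ sum (map v G)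
sumBelow-nthOr0 v [] n _ = sumBelow-zero _ n (λ i _ → cong (headOr0 v) (drop-[] i))
sumBelow-nthOr0 v (σ ∷ G) (suc n) (s≤s |G|≤n) =
  trans (sumBelow-suc (nthOr0 v (σ ∷ G)) n) (cong (v σ +_) (sumBelow-nthOr0 v G n |G|≤n))

maxBelow-nthOr0 : ∀ v G n → length G ≤ n → maxBelow (nthOr0 v G) n ≡ foldr (λ σ m → v σ ⊔ m) 0 G
maxBelow-nthOr0 v [] n _ = maxBelow-zero _ n (λ i _ → cong (headOr0 v) (drop-[] i))
maxBelow-nthOr0 v (σ ∷ G) (suc n) (s≤s |G|≤n) =
  trans (maxBelow-suc (nthOr0 v (σ ∷ G)) n) (cong (v σ ⊔_) (maxBelow-nthOr0 v G n |G|≤n))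

length≤encSet : ∀ G → length G ≤ encSet G
length≤encSet G = subst (_≤ encSet G) (length-map encS G) (length≤encL (map encS G))

isPositive-count : ∀ (p : Str → Bool) G → isPositive (count p G) ≡ bool→ℕ (any p G)
isPositive-count p [] = refl
isPositive-count p (σ ∷ G) with p σ
... | true = refl
... | false = isPositive-count p G

isPrefix⇒take : ∀ σ τ → isPrefix σ τ ≡ true → take (length σ) τ ≡ σ
isPrefix⇒take [] τ _ = refl
isPrefix⇒take (true ∷ σ) (true ∷ τ) eq = cong (true ∷_) (isPrefix⇒take σ τ eq)
isPrefix⇒take (false ∷ σ) (false ∷ τ) eq = cong (false ∷_) (isPrefix⇒take σ τ eq)

take⇒isPrefix : ∀ σ τ → take (length σ) τ ≡ σ → isPrefix σ τ ≡ true
take⇒isPrefix [] τ _ = refl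
take⇒isPrefix (true ∷ σ) (true ∷ τ) eq = take⇒isPrefix σ τ (cong (drop 1) eq)
take⇒isPrefix (false ∷ σ) (false ∷ τ) eq = take⇒isPrefix σ τ (cong (drop 1) eq)
take⇒isPrefix (true ∷ σ) (false ∷ τ) ()
take⇒isPrefix (false ∷ σ) (true ∷ τ) ()

eqIndicator-isPrefix : ∀ σ τ → eqIndicator (encS (take (length σ) τ)) (encS σ) ≡ bool→ℕ (isPrefix σ τ)
eqIndicator-isPrefix σ τ with isPrefix σ τ in eq
... | true rewrite isPrefix⇒take σ τ eq = eqIndicator-refl (encS σ)
... | false = eqIndicator-≢ _ _ λ same →
  true≢false (trans (sym (take⇒isPrefix σ τ (encS-injective _ _ same))) eq)
  where
  true≢false : true ≢ false
  true≢false ()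

-- The k-th element of a set code is the head of its k-th tail; an empty tail has code 0.
nthE : Expr 2
nthE = call headCodeE (call dropCodeE (x₀ ∷ x₁ ∷ []) ∷ [])

coverTermE : Expr 3
coverTermE = is0 (is0 (call dropCodeE (x₀ ∷ x₂ ∷ [])))
           ⊗ eqE (call takeE (call lengthE (nth ∷ []) ∷ x₁ ∷ [])) nth
  where
  nth : Expr 3
  nth = call nthE (x₀ ∷ x₂ ∷ [])

coverTermE-correct : ∀ k τ G →
  ⟦ coverTermE ⟧ (k ∷ encS τ ∷ encSet G ∷ []) ≡ nthOr0 (λ σ → bool→ℕ (isPrefix σ τ)) G k
coverTermE-correct k τ G rewrite dropCodeE-correct k (map encS G) | drop-map {f = encS} k G with drop k G
... | [] = refl
... | σ ∷ G′
  rewrite headCodeE-correct (encS σ) (encL (map encS G′)) | lengthE-correct σ | takeE-correct (length σ) τ =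
  trans (cong (_* eqIndicator (encS (take (length σ) τ)) (encS σ))
              (isPositive-pos _ (pair-pos (encS σ) (encL (map encS G′)))))
        (trans (+-identityʳ _) (eqIndicator-isPrefix σ τ))

coversE : Expr 2
coversE = is0 (is0 (sumE coverTermE x₁))

coversE-correct : ∀ τ G → ⟦ coversE ⟧ (encS τ ∷ encSet G ∷ []) ≡ bool→ℕ (coveredBy G τ)
coversE-correct τ G = begin
  ⟦ coversE ⟧ (encS τ ∷ encSet G ∷ [])
    ≡⟨ cong isPositive (sumE-correct coverTermE x₁ (encS τ ∷ encSet G ∷ [])) ⟩
  isPositive (sumBelow (λ k → ⟦ coverTermE ⟧ (k ∷ encS τ ∷ encSet G ∷ [])) (encSet G))
    ≡⟨ cong isPositive (sumBelow-cong (encSet G) (λ k _ → coverTermE-correct k τ G)) ⟩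
  isPositive (sumBelow (nthOr0 (λ σ → bool→ℕ (isPrefix σ τ)) G) (encSet G))
    ≡⟨ cong isPositive (sumBelow-nthOr0 _ G (encSet G) (length≤encSet G)) ⟩
  isPositive (count (λ σ → isPrefix σ τ) G)
    ≡⟨ isPositive-count _ G ⟩
  bool→ℕ (coveredBy G τ) ∎
  where open ≡-Reasoning

maxLenStep : Expr 3
maxLenStep = x₁ ⊕ (call lengthE (call nthE (x₀ ∷ x₂ ∷ []) ∷ []) ⊝ x₁)

maxLenE : Expr 1
maxLenE = rec (lit 0) maxLenStep x₀

maxLenE-correct : ∀ G → ⟦ maxLenE ⟧ (encSet G ∷ []) ≡ maxLen G
maxLenE-correct G = trans (go (encSet G)) (maxBelow-nthOr0 length G (encSet G) (length≤encSet G))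
  where
  nth-length : ∀ k → ⟦ lengthE ⟧ (⟦ nthE ⟧ (k ∷ encSet G ∷ []) ∷ []) ≡ nthOr0 length G k
  nth-length k rewrite dropCodeE-correct k (map encS G) | drop-map {f = encS} k G with drop k G
  ... | [] = refl
  ... | σ ∷ G′ rewrite headCodeE-correct (encS σ) (encL (map encS G′)) = lengthE-correct σ
  go : ∀ n → iterate (lit 0) maxLenStep n (encSet G ∷ []) ≡ maxBelow (nthOr0 length G) n
  go zero = refl
  go (suc n) rewrite go n | nth-length n = m+[n∸m]≡m⊔n (maxBelow (nthOr0 length G) n) (nthOr0 length G n)

-- allStrings L lists the strings of length L in the order of their codes 2^L − 1 + e, e < 2^L.
count-allStrings : ∀ L (q : Str → Bool) →
  count q (allStrings L) ≡ sumBelow (λ e → bool→ℕ (q (decS (2 ^ L ∸ 1 + e)))) (2 ^ L)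
count-allStrings zero q = +-comm (bool→ℕ (q [])) 0
count-allStrings (suc L) q
  rewrite count-allStrings-suc L q
        | count-allStrings L (λ τ → q (false ∷ τ)) | count-allStrings L (λ τ → q (true ∷ τ)) =
  sym (trans (sumBelow-even-odd _ (2 ^ L))
             (cong₂ _+_ (sumBelow-cong (2 ^ L) (λ e _ → even e)) (sumBelow-cong (2 ^ L) (λ e _ → odd e))))
  where
  K = pred (2 ^ L)
  2^L≡1+K : 2 ^ L ≡ suc K
  2^L≡1+K = sym (suc-pred (2 ^ L) {{2^-nonZero L}})
  -- both sides of these two identities are the normal forms of the code arithmetic at 2^L = 1 + K
  even-code : ∀ K e → K + suc (K + 0) + 2 * e ≡ 1 + 2 * (K + e)
  even-code = solve-∀
  odd-code : ∀ K e → K + suc (K + 0) + (1 + 2 * e) ≡ 2 + 2 * (K + e)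
  odd-code = solve-∀
  even : ∀ e → bool→ℕ (q (decS (2 * 2 ^ L ∸ 1 + 2 * e))) ≡ bool→ℕ (q (false ∷ decS (2 ^ L ∸ 1 + e)))
  even e rewrite 2^L≡1+K | even-code K e | decS-odd (K + e) = refl
  odd : ∀ e → bool→ℕ (q (decS (2 * 2 ^ L ∸ 1 + (1 + 2 * e)))) ≡ bool→ℕ (q (true ∷ decS (2 ^ L ∸ 1 + e)))
  odd e rewrite 2^L≡1+K | odd-code K e | decS-even (K + e) = refl

-- Counting the good e < N gives each good e₀ its rank; the term with rank r selects W e₀.
module Selection (good : ℕ → Bool) where

  rank : ℕ → ℕ
  rank = sumBelow (λ e → bool→ℕ (good e))

  rank-< : ∀ {e e′} → good e ≡ true → e < e′ → suc (rank e) ≤ rank e′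
  rank-< {e} good-e e<e′ =
    ≤-trans (≤-reflexive (trans (+-comm 1 (rank e)) (cong (λ b → rank e + bool→ℕ b) (sym good-e))))
            (sumBelow-monoʳ _ e<e′)

  selectTerm : (ℕ → ℕ) → ℕ → ℕ → ℕ
  selectTerm W r e = bool→ℕ (good e) * eqIndicator (rank e) r * W e

  select-rank : ∀ W N {e₀} → e₀ < N → good e₀ ≡ true → sumBelow (selectTerm W (rank e₀)) N ≡ W e₀
  select-rank W N {e₀} e₀<N good-e₀ =
    trans (sumBelow-single _ N e₀ e₀<N others)
      (trans (cong (λ b → bool→ℕ b * eqIndicator (rank e₀) (rank e₀) * W e₀) good-e₀)
        (trans (cong (λ x → (x + 0) * W e₀) (eqIndicator-refl (rank e₀))) (+-identityʳ (W e₀))))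
    where
    others : ∀ e → e < N → e ≢ e₀ → selectTerm W (rank e₀) e ≡ 0
    others e _ e≢e₀ with good e in good-e
    ... | false = refl
    ... | true = cong (λ x → (x + 0) * W e) (eqIndicator-≢ (rank e) (rank e₀) ranks-differ)
      where
      ranks-differ : rank e ≢ rank e₀
      ranks-differ same with <-cmp e e₀
      ... | tri< e<e₀ _ _ = <-irrefl same (rank-< good-e e<e₀)
      ... | tri≈ _ e≡e₀ _ = e≢e₀ e≡e₀
      ... | tri> _ _ e₀<e = <-irrefl (sym same) (rank-< good-e₀ e₀<e)

codeE : Expr 2
codeE = (pow2 (call maxLenE (x₁ ∷ [])) ⊝ lit 1) ⊕ x₀

coveredAtE : Expr 2
coveredAtE = call coversE (codeE ∷ x₁ ∷ [])

rankE : Expr 2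
rankE = sumE (call coveredAtE (x₀ ∷ x₂ ∷ [])) x₀

selectTermE : Expr 3
selectTermE = call coveredAtE (x₀ ∷ x₁ ∷ []) ⊗ eqE (call rankE (x₀ ∷ x₁ ∷ [])) x₂ ⊗ call codeE (x₀ ∷ x₁ ∷ [])

selectE : Expr 2
selectE = sumE selectTermE (pow2 (call maxLenE (x₀ ∷ [])))

∈⇒coveredBy : ∀ X G {L} → maxLen G ≤ L → X ∈[ G ] → coveredBy G (X ↾ L) ≡ true
∈⇒coveredBy X (σ ∷ G) {L} max≤L (here X↾σ)
  rewrite take⇒isPrefix σ (X ↾ L) (trans (take-↾ X (≤-trans (m≤m⊔n (length σ) _) max≤L)) X↾σ) = refl
∈⇒coveredBy X (σ ∷ G) {L} max≤L (there X∈G)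
  rewrite ∈⇒coveredBy X G (≤-trans (m≤n⊔m (length σ) _) max≤L) X∈G with isPrefix σ (X ↾ L)
... | true = refl
... | false = refl

module RankedCover (G : List Str) where
  L = maxLen G

  code : ℕ → ℕ
  code e = 2 ^ L ∸ 1 + e

  covered : ℕ → Bool
  covered e = coveredBy G (decS (code e))

  open Selection covered

  codeE-correct : ∀ e → ⟦ codeE ⟧ (e ∷ encSet G ∷ []) ≡ code e
  codeE-correct e rewrite maxLenE-correct G = refl

  coveredAtE-correct : ∀ e → ⟦ coveredAtE ⟧ (e ∷ encSet G ∷ []) ≡ bool→ℕ (covered e)
  coveredAtE-correct e rewrite codeE-correct e =
    trans (cong (λ m → ⟦ coversE ⟧ (m ∷ encSet G ∷ [])) (sym (encS-decS (code e))))
          (coversE-correct (decS (code e)) G)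

  rankE-correct : ∀ e → ⟦ rankE ⟧ (e ∷ encSet G ∷ []) ≡ rank e
  rankE-correct e = trans (sumE-correct _ x₀ (e ∷ encSet G ∷ [])) (sumBelow-cong e (λ i _ → coveredAtE-correct i))

  selectE-correct : ∀ r → ⟦ selectE ⟧ (encSet G ∷ r ∷ []) ≡ sumBelow (selectTerm code r) (2 ^ L)
  selectE-correct r = trans (sumE-correct selectTermE (pow2 (call maxLenE (x₀ ∷ []))) (encSet G ∷ r ∷ []))
    (trans (cong (λ m → sumBelow (λ e → ⟦ selectTermE ⟧ (e ∷ encSet G ∷ r ∷ [])) (2 ^ m)) (maxLenE-correct G))
           (sumBelow-cong (2 ^ L) (λ e _ → term e)))
    where
    term : ∀ e → ⟦ selectTermE ⟧ (e ∷ encSet G ∷ r ∷ []) ≡ selectTerm code r e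
    term e rewrite coveredAtE-correct e | rankE-correct e | codeE-correct e = refl

  countCovered≡rank : countCovered G ≡ rank (2 ^ L)
  countCovered≡rank = trans (length-filterᵇ (coveredBy G) (allStrings L)) (count-allStrings L (coveredBy G))

  module _ (X : Real) (X∈G : X ∈[ G ]) where
    e₀ : ℕ
    e₀ = encS (X ↾ L) ∸ (2 ^ L ∸ 1)

    code-e₀ : code e₀ ≡ encS (X ↾ L)
    code-e₀ = proj₁ (encS-offset (X ↾ L) (length-↾ X L))

    e₀<2^L : e₀ < 2 ^ L
    e₀<2^L = proj₂ (encS-offset (X ↾ L) (length-↾ X L))

    covered-e₀ : covered e₀ ≡ true
    covered-e₀ = trans (cong (λ m → coveredBy G (decS m)) code-e₀)
                   (trans (cong (coveredBy G) (decS-encS (X ↾ L))) (∈⇒coveredBy X G ≤-refl X∈G))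

    rank-X : ℕ
    rank-X = rank e₀

    selectE-rank : ⟦ selectE ⟧ (encSet G ∷ rank-X ∷ []) ≡ encS (X ↾ L)
    selectE-rank = trans (selectE-correct (rank e₀)) (trans (select-rank code (2 ^ L) e₀<2^L covered-e₀) code-e₀)

    rank<countCovered : rank-X < countCovered G
    rank<countCovered = subst (rank-X <_) (sym countCovered≡rank) (rank-< covered-e₀ e₀<2^L)

length-+-≤ : ∀ τ c r L → suc (encS τ) ≡ pair c r → suc r * 2 ^ (1 + 2 * c) ≤ 2 ^ L → length τ + c ≤ L
length-+-≤ τ c r L code≡ bound = <⇒≤ (2^-cancel-< (begin-strict
  2 ^ (length τ + c)            ≡⟨ ^-distribˡ-+-* 2 (length τ) c ⟩
  2 ^ length τ * 2 ^ c          ≤⟨ *-monoˡ-≤ (2 ^ c) (subst (2 ^ length τ ≤_) code≡ (2^length≤1+encS τ)) ⟩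
  pair c r * 2 ^ c              <⟨ *-monoˡ-< (2 ^ c) {{2^-nonZero c}} (*-monoʳ-< (2 ^ c) {{2^-nonZero c}} (n<1+n _)) ⟩
  2 ^ c * (2 + 2 * r) * 2 ^ c   ≡⟨ regroup (2 ^ c) r ⟩
  suc r * (2 * (2 ^ c * 2 ^ c)) ≡⟨ cong (λ p → suc r * (2 * p)) (sym 2^[c+c]) ⟩
  suc r * 2 ^ (1 + 2 * c)       ≤⟨ bound ⟩
  2 ^ L                         ∎))
  where
  open ≤-Reasoning
  regroup : ∀ P r → P * (2 + 2 * r) * P ≡ suc r * (2 * (P * P))
  regroup = solve-∀
  2^[c+c] : 2 ^ (c + (c + 0)) ≡ 2 ^ c * 2 ^ c
  2^[c+c] rewrite +-identityʳ c = ^-distribˡ-+-* 2 c c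

-- The decoder reads an input as pair c r − 1 and outputs the r-th covered string of G (2c + 1).
module CoverDecoder (G : ℕ → List Str) (G-PR : IsPRSeq G) where
  pG = proj₁ G-PR

  decoderE : Expr 1
  decoderE = call selectE (apply pG (lit 1 ⊕ lit 2 ⊗ call headCodeE (code ∷ [])) ∷ call tailCodeE (code ∷ []) ∷ [])
    where
    code : Expr 1
    code = lit 1 ⊕ x₀

  decoder : Str → Str
  decoder τ = decS (⟦ decoderE ⟧ (encS τ ∷ []))

  decoder-PR : IsPRStr decoder
  decoder-PR = Expr⇒IsPRStr decoderE {decoder} (λ τ → sym (encS-decS _))

  outputLength : ℕ → ℕ
  outputLength c = maxLen (G (1 + 2 * c))

  outputLength-PR : IsPR outputLength
  outputLength-PR = Expr⇒IsPR (call maxLenE (apply pG (lit 1 ⊕ lit 2 ⊗ x₀) ∷ []))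
    λ c → trans (cong (λ m → ⟦ maxLenE ⟧ (m ∷ [])) (proj₂ G-PR (1 + 2 * c))) (maxLenE-correct (G (1 + 2 * c)))

  module _ (X : Real) (X∈G : ∀ n → X ∈[ G n ]) (measure : ∀ n → μ[ G n ]≤2^- n) where

    decoder-compresses : ∀ c → ∃ λ τ → (decoder τ ≡ X ↾ outputLength c) × (length τ + c ≤ outputLength c)
    decoder-compresses c = τ , decodes , length-+-≤ τ c r L 1+encS-τ bound
      where
      n = 1 + 2 * c
      open RankedCover (G n)
      r = rank-X X (X∈G n)
      τ = decS (pair c r ∸ 1)
      1+encS-τ : suc (encS τ) ≡ pair c r
      1+encS-τ = trans (cong suc (encS-decS (pair c r ∸ 1))) (trans (+-comm 1 _) (m∸n+n≡m (pair-pos c r)))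
      bound : suc r * 2 ^ n ≤ 2 ^ L
      bound = ≤-trans (*-monoˡ-≤ (2 ^ n) (rank<countCovered X (X∈G n))) (measure n)
      decodes : decoder τ ≡ X ↾ L
      decodes = begin
        readCode (suc (encS τ))
          ≡⟨ cong readCode 1+encS-τ ⟩
        readCode (pair c r)
          ≡⟨ cong₂ select (headCodeE-correct c r) (tailCodeE-correct c r) ⟩
        decS (⟦ selectE ⟧ (evalPR pG (n ∷ []) ∷ r ∷ []))
          ≡⟨ cong (λ m → decS (⟦ selectE ⟧ (m ∷ r ∷ []))) (proj₂ G-PR n) ⟩
        decS (⟦ selectE ⟧ (encSet (G n) ∷ r ∷ []))
          ≡⟨ cong decS (selectE-rank X (X∈G n)) ⟩
        decS (encS (X ↾ L))
          ≡⟨ decS-encS (X ↾ L) ⟩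
        X ↾ L ∎
        where
        open ≡-Reasoning
        select : ℕ → ℕ → Str
        select a b = decS (⟦ selectE ⟧ (evalPR pG (1 + 2 * a ∷ []) ∷ b ∷ []))
        readCode : ℕ → Str
        readCode m = select (⟦ headCodeE ⟧ (m ∷ [])) (⟦ tailCodeE ⟧ (m ∷ []))

_∈?[_] : ∀ X G → Dec (X ∈[ G ])
X ∈?[ G ] = any? (λ σ → ≡-dec _≟ᵇ_ (X ↾ length σ) σ) G

martinLöf⇒kolmogorov : ∀ X → MLBPRandom X → KolmogorovBPRandom X
martinLöf⇒kolmogorov X random M M-PR (f , f-PR , compress) =
  random test test-isPRTest (λ (n , X∉) → X∉ (test-∋ X compress n))
  where
  open CompressionTest f M
  open CompressionTestPR f M f-PR M-PR

kolmogorov⇒martinLöf : ∀ X → KolmogorovBPRandom X → MLBPRandom X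
kolmogorov⇒martinLöf X random G (G-PR , measure) ¬∃X∉ =
  random decoder decoder-PR (outputLength , outputLength-PR , decoder-compresses X X∈G measure)
  where
  open CoverDecoder G G-PR
  -- membership in a clopen set is decidable, which removes the double negation
  X∈G : ∀ n → X ∈[ G n ]
  X∈G n with X ∈?[ G n ]
  ... | yes X∈ = X∈
  ... | no X∉ = ⊥-elim (¬∃X∉ (n , X∉))

kolmogorov⇒quick : ∀ X → KolmogorovBPRandom X → QuickProcessBPRandom X
kolmogorov⇒quick X random M M-quick = random M (proj₁ M-quick)

quick⇒kolmogorov : ∀ X → QuickProcessBPRandom X → KolmogorovBPRandom X
quick⇒kolmogorov X random M M-PR (f , f-PR , compress) =
  random quick quick-isQuickProcess (ℓ , ℓ-PR , quick-input)
  where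
  open QuickProcess f M
  open QuickProcessPR f M f-PR M-PR
  open Compressed X (λ c → proj₁ (compress c)) (λ c → proj₁ (proj₂ (compress c)))
                    (λ c → proj₂ (proj₂ (compress c)))

theorem2p4 : (X : Real) →
    (MLBPRandom X ⇔ KolmogorovBPRandom X) × (KolmogorovBPRandom X ⇔ QuickProcessBPRandom X)
theorem2p4 X = mk⇔ (martinLöf⇒kolmogorov X) (kolmogorov⇒martinLöf X)
             , mk⇔ (kolmogorov⇒quick X) (quick⇒kolmogorov X)
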